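{- Let $m$ be a positive integer and let $I_m$ be the graph on vertex set $\{1,2\}$ with exactly $m$ parallel edges between $1$ and $2$ (and no other edges). Then \[ h^\ast(\mathcal{C}_{I_m};z)=(1+z)^m+2mz(1+z)^{m-1}. \]
   Context: For a graph $G=(V,E)$ (finite, undirected, edge multiset), with $\mathbf{e}_\alpha$ the standard unit vectors of $\mathbb{R}^{V\cup E}$, the cosmological polytope is $\mathcal{C}_G=\mathrm{conv}(\mathbf{e}_i+\mathbf{e}_j-\mathbf{e}_f,\ \mathbf{e}_i-\mathbf{e}_j+\mathbf{e}_f,\ -\mathbf{e}_i+\mathbf{e}_j+\mathbf{e}_f : f\in E\text{ with endpoints }i,j)$, of dimension $|V|+|E|-1$. For a $d$-dimensional lattice polytope $P\subset\mathbb{R}^N$, $h^\ast(P;z)$ is defined by $1+\sum_{t\ge1}|tP\cap\mathbb{Z}^N|z^t=h^\ast(P;z)/(1-z)^{d+1}$. -}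

module Defs where

open import Data.Nat as ℕ using (ℕ; zero; suc)
open import Data.Integer as ℤ using (ℤ; +_; -[1+_])
open import Data.Rational as ℚ using (ℚ; 0ℚ; 1ℚ; _/_)
open import Data.Fin using (Fin; zero; suc; _≟_)
open import Data.Vec using (Vec; lookup)
open import Data.List using (List; length)
open import Data.List.Relation.Unary.Unique.Propositional using (Unique)
open import Data.List.Membership.Propositional using (_∈_)
open import Data.Product using (Σ; _×_; _,_)
open import Function.Bundles using (_⇔_)
open import Relation.Binary.PropositionalEquality using (_≡_)
open import Relation.Nullary using (yes; no)

sumℚ : ∀ {n} → (Fin n → ℚ) → ℚ
sumℚ {zero} f = 0ℚ
sumℚ {suc n} f = f zero ℚ.+ sumℚ (λ i → f (suc i))

sumℤ-upto : ℕ → (ℕ → ℤ) → ℤ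
sumℤ-upto zero f = f 0
sumℤ-upto (suc n) f = sumℤ-upto n f ℤ.+ f (suc n)

-- The graph I_m: vertices Fin 2 (vertex 1 = zero, vertex 2 = suc zero),
-- edges Fin m, every edge has endpoints zero and suc zero.
-- A point of ℝ^{V ∪ E} is a pair (vertex coordinates, edge coordinates).

ℤPoint : ℕ → Set
ℤPoint m = Vec ℤ 2 × Vec ℤ m

toℚ : ℤ → ℚ
toℚ x = x / 1

-- Generators of the cosmological polytope, for edge f with endpoints i=0, j=1:
--   k = 0 : e_i + e_j - e_f
--   k = 1 : e_i - e_j + e_f
--   k = 2 : -e_i + e_j + e_f
genV : ∀ {m} → Fin m → Fin 3 → Fin 2 → ℚ
genV f zero       _          = 1ℚ
genV f (suc zero) zero       = 1ℚ
genV f (suc zero) (suc zero) = ℚ.- 1ℚ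
genV f (suc (suc zero)) zero       = ℚ.- 1ℚ
genV f (suc (suc zero)) (suc zero) = 1ℚ

edgeSign : Fin 3 → ℚ
edgeSign zero = ℚ.- 1ℚ
edgeSign (suc _) = 1ℚ

genE : ∀ {m} → Fin m → Fin 3 → Fin m → ℚ
genE f k g with f ≟ g
... | yes _ = edgeSign k
... | no  _ = 0ℚ

InDilate : (m t : ℕ) → ℤPoint m → Set
InDilate m t (xv , xe) =
  Σ (Fin m → Fin 3 → ℚ) λ c →
    (∀ f k → 0ℚ ℚ.≤ c f k) ×
    (sumℚ (λ f → sumℚ (λ k → c f k)) ≡ toℚ (+ t)) ×
    (∀ i → sumℚ (λ f → sumℚ (λ k → c f k ℚ.* genV f k i)) ≡ toℚ (lookup xv i)) ×
    (∀ g → sumℚ (λ f → sumℚ (λ k → c f k ℚ.* genE f k g)) ≡ toℚ (lookup xe g))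

HasCard : {A : Set} → (A → Set) → ℕ → Set
HasCard {A} P n = Σ (List A) λ l → Unique l × (∀ a → (a ∈ l) ⇔ P a) × (length l ≡ n)

Series : Set
Series = ℕ → ℤ

constS : ℤ → Series
constS a zero = a
constS a (suc _) = + 0

zS : Series
zS 1 = + 1
zS _ = + 0

_+S_ : Series → Series → Series
(a +S b) n = a n ℤ.+ b n

_*S_ : Series → Series → Series
(a *S b) n = sumℤ-upto n (λ i → a i ℤ.* b (n ℕ.∸ i))

_^S_ : Series → ℕ → Series
a ^S zero = constS (+ 1)
a ^S suc k = a *S (a ^S k)

ehrhartS : (ℕ → ℕ) → Series
ehrhartS L zero = + 1
ehrhartS L (suc t) = + L (suc t)

hstarClaim : ℕ → Series
hstarClaim m =
  ((constS (+ 1) +S zS) ^S m) +S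
  (constS (+ (2 ℕ.* m)) *S (zS *S ((constS (+ 1) +S zS) ^S (m ℕ.∸ 1))))

-- dim C_{I_m} = |V| + |E| - 1 = m + 1, so the denominator is (1-z)^(m+2)
oneMinusZ : Series
oneMinusZ = constS (+ 1) +S (constS (-[1+ 0 ]) *S zS)

-- A point (x₁, x₂, y) ∈ ℤ² × ℤᵐ lies in t·C_{I_m} (m ≥ 1) iff x₁ ≤ t, x₂ ≤ t, x₁ + x₂ + Σy = t and
-- ‖y‖₁ ≤ t.  Necessity is read off the total weights A, B, D of the three kinds of generators:
-- t = A + B + D, x₁ = A + B − D, x₂ = A − B + D and Σy = −A + B + D.  For sufficiency each y_g is
-- split into its positive and negative part, both raised by a share of the slack t − ‖y‖₁, and a
-- ratio q ∈ [0, 1] distributes the positive part between the second and third generator.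
-- So over each y of the cross-polytope t·◇_m the lattice points are x₁ = t − k, 0 ≤ k ≤ t + Σy, and
-- since Σy sums to 0 over the symmetric ◇_m, L(t) = (t + 1)·X_m(t) with X_m(t) = #(t·◇_m ∩ ℤᵐ).
-- Writing Δ for multiplication by 1 − z, the recursion X_{m+1}(t) = X_m(t) + 2 Σ_{j<t} X_m(j) gives
-- Δ^{m+1} X_m = (1 + z)^m; the weight t + 1 turns X_m into the coefficients of (z·X_m)′, and the
-- Leibniz rule for one more Δ yields (1 + z)^m + 2m z (1 + z)^{m−1}.

module Submission where

open import Defs
open import Algebra.Bundles using (CommutativeRing)
import Algebra.Properties.Semiring.Sum as SemiringSum
open import Data.Empty using (⊥-elim)
open import Data.Fin as Fin using (Fin; zero; suc)
open import Data.Fin.Properties using (suc-injective)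
open import Data.Integer as ℤ using (ℤ; +_; -[1+_]; +≤+)
import Data.Integer.Properties as ℤP
open import Data.Integer.Tactic.RingSolver using (solve-∀)
open import Data.List using (List; []; _∷_; _++_; map; length; downFrom)
open import Data.List.Membership.Propositional using (_∈_)
open import Data.List.Membership.Propositional.Properties
  using (∈-++⁻; ∈-++⁺ˡ; ∈-++⁺ʳ; ∈-map⁻; ∈-map⁺; ∈-downFrom⁺; ∈-downFrom⁻)
import Data.List.Properties as LP
open import Data.List.Relation.Unary.All using ([])
import Data.List.Relation.Unary.All as All
open import Data.List.Relation.Unary.AllPairs using ([]; _∷_)
open import Data.List.Relation.Unary.Any using (here; there)
open import Data.List.Relation.Unary.Unique.Propositional using (Unique)
import Data.List.Relation.Unary.Unique.Propositional.Properties as Unique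
open import Data.Nat as ℕ using (ℕ; zero; suc; z≤n; _∸_)
import Data.Nat.Properties as ℕP
open import Data.Nat.Tactic.RingSolver using () renaming (solve-∀ to ℕ-solve-∀)
open import Data.Product using (Σ; ∃-syntax; _×_; _,_; proj₁; proj₂)
open import Data.Rational as ℚ using (ℚ; 0ℚ; 1ℚ; ½; 1/_)
import Data.Rational.Properties as ℚP
open import Data.Rational.Solver using (module +-*-Solver)
import Data.Rational.Unnormalised as ℚᵘ
import Data.Rational.Unnormalised.Properties as ℚᵘP
open import Data.Sum using (_⊎_; inj₁; inj₂)
open import Data.Vec using (Vec; []; _∷_; lookup)
open import Data.Vec.Properties using (∷-injective; ∷-injectiveˡ; ∷-injectiveʳ)
open import Function using (_∘_)
open import Function.Bundles using (_⇔_; mk⇔)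
open import Relation.Binary.PropositionalEquality
open import Relation.Nullary using (¬_; yes; no)

module PowerSeries where

  open import Data.Integer using (_+_; _*_; _-_)
  open ≡-Reasoning

  sumℤ-upto-cong : ∀ n {f g : ℕ → ℤ} → f ≗ g → sumℤ-upto n f ≡ sumℤ-upto n g
  sumℤ-upto-cong zero    f≗g = f≗g 0
  sumℤ-upto-cong (suc n) f≗g = cong₂ _+_ (sumℤ-upto-cong n f≗g) (f≗g (suc n))

  sumℤ-upto-unfoldˡ : ∀ n (f : ℕ → ℤ) → sumℤ-upto (suc n) f ≡ f 0 + sumℤ-upto n (f ∘ suc)
  sumℤ-upto-unfoldˡ zero    f = refl
  sumℤ-upto-unfoldˡ (suc n) f = begin
    sumℤ-upto (suc n) f + f (suc (suc n))           ≡⟨ cong (_+ f (suc (suc n))) (sumℤ-upto-unfoldˡ n f) ⟩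
    f 0 + sumℤ-upto n (f ∘ suc) + f (suc (suc n))   ≡⟨ ℤP.+-assoc (f 0) _ _ ⟩
    f 0 + sumℤ-upto (suc n) (f ∘ suc)               ∎

  sumℤ-upto-linear : ∀ n c (f g : ℕ → ℤ) →
               sumℤ-upto n (λ i → f i + c * g i) ≡ sumℤ-upto n f + c * sumℤ-upto n g
  sumℤ-upto-linear zero    c f g = refl
  sumℤ-upto-linear (suc n) c f g = begin
    sumℤ-upto n (λ i → f i + c * g i) + (f (suc n) + c * g (suc n))
      ≡⟨ cong (_+ (f (suc n) + c * g (suc n))) (sumℤ-upto-linear n c f g) ⟩
    sumℤ-upto n f + c * sumℤ-upto n g + (f (suc n) + c * g (suc n))
      ≡⟨ regroup (sumℤ-upto n f) (sumℤ-upto n g) (f (suc n)) (g (suc n)) c ⟩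
    sumℤ-upto (suc n) f + c * sumℤ-upto (suc n) g ∎
    where
    regroup : ∀ s t x y c → s + c * t + (x + c * y) ≡ (s + x) + c * (t + y)
    regroup = solve-∀

  sumℤ-upto-zero : ∀ n {f : ℕ → ℤ} → (∀ i → f i ≡ + 0) → sumℤ-upto n f ≡ + 0
  sumℤ-upto-zero zero    f≡0 = f≡0 0
  sumℤ-upto-zero (suc n) f≡0 = cong₂ _+_ (sumℤ-upto-zero n f≡0) (f≡0 (suc n))

  infixr 7 _·S_

  _·S_ : ℤ → Series → Series
  (c ·S a) n = c * a n

  shift : Series → Series
  shift a zero    = + 0
  shift a (suc n) = a n

  Δ : Series → Series
  Δ a n = a n - shift a n

  Δ^ : ℕ → Series → Series
  Δ^ zero    a = a
  Δ^ (suc k) a = Δ (Δ^ k a)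

  *S-congˡ : ∀ {b b′} (a : Series) → b ≗ b′ → (b *S a) ≗ (b′ *S a)
  *S-congˡ a b≗b′ n = sumℤ-upto-cong n (λ i → cong (_* a (n ℕ.∸ i)) (b≗b′ i))

  *S-linearˡ : ∀ (b b′ a : Series) c → ((b +S (c ·S b′)) *S a) ≗ ((b *S a) +S (c ·S (b′ *S a)))
  *S-linearˡ b b′ a c n = begin
    sumℤ-upto n (λ i → (b i + c * b′ i) * a (n ℕ.∸ i))
      ≡⟨ sumℤ-upto-cong n (λ i → distrib (b i) (b′ i) c (a (n ℕ.∸ i))) ⟩
    sumℤ-upto n (λ i → b i * a (n ℕ.∸ i) + c * (b′ i * a (n ℕ.∸ i)))
      ≡⟨ sumℤ-upto-linear n c _ _ ⟩
    (b *S a) n + c * (b′ *S a) n ∎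
    where
    distrib : ∀ x y c z → (x + c * y) * z ≡ x * z + c * (y * z)
    distrib = solve-∀

  *S-unfoldˡ : ∀ (b a : Series) n → (b *S a) (suc n) ≡ b 0 * a (suc n) + ((b ∘ suc) *S a) n
  *S-unfoldˡ b a n = sumℤ-upto-unfoldˡ n (λ i → b i * a (suc n ℕ.∸ i))

  constS-*S : ∀ c (a : Series) → (constS c *S a) ≗ (c ·S a)
  constS-*S c a zero    = refl
  constS-*S c a (suc n) = begin
    (constS c *S a) (suc n)
      ≡⟨ *S-unfoldˡ (constS c) a n ⟩
    c * a (suc n) + ((constS c ∘ suc) *S a) n
      ≡⟨ cong (_+_ (c * a (suc n))) (sumℤ-upto-zero n (λ i → ℤP.*-zeroˡ (a (n ℕ.∸ i)))) ⟩
    c * a (suc n) + + 0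
      ≡⟨ ℤP.+-identityʳ _ ⟩
    c * a (suc n) ∎

  shift-*S : ∀ (b a : Series) → (shift b *S a) ≗ shift (b *S a)
  shift-*S b a zero    = ℤP.*-zeroˡ (a 0)
  shift-*S b a (suc n) = begin
    (shift b *S a) (suc n)        ≡⟨ *S-unfoldˡ (shift b) a n ⟩
    + 0 * a (suc n) + (b *S a) n  ≡⟨ cong (_+ (b *S a) n) (ℤP.*-zeroˡ (a (suc n))) ⟩
    + 0 + (b *S a) n              ≡⟨ ℤP.+-identityˡ _ ⟩
    (b *S a) n                    ∎

  shift-cong : ∀ {a b} → a ≗ b → shift a ≗ shift b
  shift-cong a≗b zero    = refl
  shift-cong a≗b (suc n) = a≗b n

  one-*S : ∀ (a : Series) → (constS (+ 1) *S a) ≗ a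
  one-*S a n = trans (constS-*S (+ 1) a n) (ℤP.*-identityˡ (a n))

  zS≗shift-one : zS ≗ shift (constS (+ 1))
  zS≗shift-one zero          = refl
  zS≗shift-one (suc zero)    = refl
  zS≗shift-one (suc (suc n)) = refl

  zS-*S : ∀ (a : Series) → (zS *S a) ≗ shift a
  zS-*S a n = begin
    (zS *S a) n                    ≡⟨ *S-congˡ a zS≗shift-one n ⟩
    (shift (constS (+ 1)) *S a) n  ≡⟨ shift-*S (constS (+ 1)) a n ⟩
    shift (constS (+ 1) *S a) n    ≡⟨ shift-cong (one-*S a) n ⟩
    shift a n                      ∎

  oneMinusZ-*S : ∀ (a : Series) → (oneMinusZ *S a) ≗ (a +S (-[1+ 0 ] ·S shift a))
  oneMinusZ-*S a n = begin
    (oneMinusZ *S a) n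
      ≡⟨ *S-congˡ a (λ i → cong (_+_ (constS (+ 1) i)) (constS-*S -[1+ 0 ] zS i)) n ⟩
    ((constS (+ 1) +S (-[1+ 0 ] ·S zS)) *S a) n
      ≡⟨ *S-linearˡ (constS (+ 1)) zS a -[1+ 0 ] n ⟩
    (constS (+ 1) *S a) n + -[1+ 0 ] * (zS *S a) n
      ≡⟨ cong₂ (λ u v → u + -[1+ 0 ] * v) (one-*S a n) (zS-*S a n) ⟩
    a n + -[1+ 0 ] * shift a n ∎

  Δ-as-combination : ∀ (a : Series) → Δ a ≗ (a +S (-[1+ 0 ] ·S shift a))
  Δ-as-combination a n = minus (a n) (shift a n)
    where
    minus : ∀ x y → x - y ≡ x + -[1+ 0 ] * y
    minus = solve-∀

  oneMinusZ-*S-*S : ∀ (q e : Series) → ((oneMinusZ *S q) *S e) ≗ Δ (q *S e)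
  oneMinusZ-*S-*S q e n = begin
    ((oneMinusZ *S q) *S e) n
      ≡⟨ *S-congˡ e (oneMinusZ-*S q) n ⟩
    ((q +S (-[1+ 0 ] ·S shift q)) *S e) n
      ≡⟨ *S-linearˡ q (shift q) e -[1+ 0 ] n ⟩
    (q *S e) n + -[1+ 0 ] * (shift q *S e) n
      ≡⟨ cong (λ v → (q *S e) n + -[1+ 0 ] * v) (shift-*S q e n) ⟩
    (q *S e) n + -[1+ 0 ] * shift (q *S e) n
      ≡⟨ Δ-as-combination (q *S e) n ⟨
    Δ (q *S e) n ∎

  shift-+ : ∀ (a b : Series) → shift (a +S b) ≗ (shift a +S shift b)
  shift-+ a b zero    = refl
  shift-+ a b (suc n) = refl

  shift-· : ∀ c (a : Series) → shift (c ·S a) ≗ (c ·S shift a)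
  shift-· c a zero    = sym (ℤP.*-zeroʳ c)
  shift-· c a (suc n) = refl

  Δ-cong : ∀ {a b} → a ≗ b → Δ a ≗ Δ b
  Δ-cong a≗b n = cong₂ _-_ (a≗b n) (shift-cong a≗b n)

  Δ-+ : ∀ (a b : Series) → Δ (a +S b) ≗ (Δ a +S Δ b)
  Δ-+ a b n = begin
    (a n + b n) - shift (a +S b) n           ≡⟨ cong ((a n + b n) -_) (shift-+ a b n) ⟩
    (a n + b n) - (shift a n + shift b n)    ≡⟨ regroup (a n) (b n) (shift a n) (shift b n) ⟩
    (a n - shift a n) + (b n - shift b n)    ∎
    where
    regroup : ∀ x y z w → (x + y) - (z + w) ≡ (x - z) + (y - w)
    regroup = solve-∀

  Δ-· : ∀ c (a : Series) → Δ (c ·S a) ≗ (c ·S Δ a)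
  Δ-· c a n = begin
    c * a n - shift (c ·S a) n   ≡⟨ cong (c * a n -_) (shift-· c a n) ⟩
    c * a n - c * shift a n      ≡⟨ factor c (a n) (shift a n) ⟩
    c * (a n - shift a n)        ∎
    where
    factor : ∀ c x y → c * x - c * y ≡ c * (x - y)
    factor = solve-∀

  Δ-shift : ∀ (a : Series) → Δ (shift a) ≗ shift (Δ a)
  Δ-shift a zero          = refl
  Δ-shift a (suc zero)    = refl
  Δ-shift a (suc (suc n)) = refl

  Δ^-cong : ∀ k {a b} → a ≗ b → Δ^ k a ≗ Δ^ k b
  Δ^-cong zero    a≗b = a≗b
  Δ^-cong (suc k) a≗b = Δ-cong (Δ^-cong k a≗b)

  Δ^-+ : ∀ k (a b : Series) → Δ^ k (a +S b) ≗ (Δ^ k a +S Δ^ k b)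
  Δ^-+ zero    a b n = refl
  Δ^-+ (suc k) a b n = trans (Δ-cong (Δ^-+ k a b) n) (Δ-+ (Δ^ k a) (Δ^ k b) n)

  Δ^-shift : ∀ k (a : Series) → Δ^ k (shift a) ≗ shift (Δ^ k a)
  Δ^-shift zero    a n = refl
  Δ^-shift (suc k) a n = trans (Δ-cong (Δ^-shift k a) n) (Δ-shift (Δ^ k a) n)

  Δ^-suc : ∀ k (a : Series) → Δ^ (suc k) a ≗ Δ^ k (Δ a)
  Δ^-suc zero    a n = refl
  Δ^-suc (suc k) a n = Δ-cong (Δ^-suc k a) n

  oneMinusZ^-*S : ∀ k (e : Series) → ((oneMinusZ ^S k) *S e) ≗ Δ^ k e
  oneMinusZ^-*S zero    e n = one-*S e n
  oneMinusZ^-*S (suc k) e n =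
    trans (oneMinusZ-*S-*S (oneMinusZ ^S k) e n) (Δ-cong (oneMinusZ^-*S k e) n)

  -- Coefficients of (z · a)′.
  derivZ : Series → Series
  derivZ a n = + suc n * a n

  Δ-derivZ : ∀ (a : Series) → Δ (derivZ a) ≗ (derivZ (Δ a) +S shift a)
  Δ-derivZ a zero    = base (a 0)
    where
    base : ∀ x → + 1 * x - + 0 ≡ + 1 * (x - + 0) + + 0
    base = solve-∀
  Δ-derivZ a (suc n) = begin
    + suc (suc n) * a (suc n) - + suc n * a n
      ≡⟨ cong₂ (λ u v → u * a (suc n) - v * a n) (ℤP.pos-+ 2 n) (ℤP.pos-+ 1 n) ⟩
    (+ 2 + + n) * a (suc n) - (+ 1 + + n) * a n
      ≡⟨ leibniz (+ n) (a (suc n)) (a n) ⟩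
    (+ 2 + + n) * (a (suc n) - a n) + a n
      ≡⟨ cong (λ u → u * (a (suc n) - a n) + a n) (ℤP.pos-+ 2 n) ⟨
    + suc (suc n) * (a (suc n) - a n) + a n ∎
    where
    leibniz : ∀ x y z → (+ 2 + x) * y - (+ 1 + x) * z ≡ (+ 2 + x) * (y - z) + z
    leibniz = solve-∀

  Δ^-derivZ : ∀ k (a : Series) →
              Δ^ (suc k) (derivZ a) ≗ (derivZ (Δ^ (suc k) a) +S (+ suc k ·S shift (Δ^ k a)))
  Δ^-derivZ zero    a n = trans (Δ-derivZ a n) (cong (_+_ (derivZ (Δ a) n)) (sym (ℤP.*-identityˡ _)))
  Δ^-derivZ (suc k) a n = begin
    Δ (Δ^ (suc k) (derivZ a)) n
      ≡⟨ Δ-cong (Δ^-derivZ k a) n ⟩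
    Δ (derivZ b +S (+ suc k ·S shift (Δ^ k a))) n
      ≡⟨ Δ-+ (derivZ b) (+ suc k ·S shift (Δ^ k a)) n ⟩
    Δ (derivZ b) n + Δ (+ suc k ·S shift (Δ^ k a)) n
      ≡⟨ cong₂ _+_ (Δ-derivZ b n) (Δ-· (+ suc k) (shift (Δ^ k a)) n) ⟩
    (derivZ (Δ b) n + shift b n) + + suc k * Δ (shift (Δ^ k a)) n
      ≡⟨ cong (λ v → (derivZ (Δ b) n + shift b n) + + suc k * v) (Δ-shift (Δ^ k a) n) ⟩
    (derivZ (Δ b) n + shift b n) + + suc k * shift b n
      ≡⟨ collect (derivZ (Δ b) n) (shift b n) (+ suc k) ⟩
    derivZ (Δ b) n + (+ 1 + + suc k) * shift b n
      ≡⟨ cong (λ u → derivZ (Δ b) n + u * shift b n) (ℤP.pos-+ 1 (suc k)) ⟨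
    derivZ (Δ b) n + + suc (suc k) * shift b n ∎
    where
    b = Δ^ (suc k) a
    collect : ∀ x y c → (x + y) + c * y ≡ x + (+ 1 + c) * y
    collect = solve-∀

  binomialS : ℕ → Series
  binomialS m = (constS (+ 1) +S zS) ^S m

  pascal : ∀ m → binomialS (suc m) ≗ (binomialS m +S shift (binomialS m))
  pascal m n = begin
    ((constS (+ 1) +S zS) *S B) n
      ≡⟨ *S-congˡ B (λ i → cong (_+_ (constS (+ 1) i)) (ℤP.*-identityˡ (zS i))) n ⟨
    ((constS (+ 1) +S (+ 1 ·S zS)) *S B) n
      ≡⟨ *S-linearˡ (constS (+ 1)) zS B (+ 1) n ⟩
    (constS (+ 1) *S B) n + + 1 * (zS *S B) n
      ≡⟨ cong₂ _+_ (one-*S B n) (trans (ℤP.*-identityˡ _) (zS-*S B n)) ⟩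
    B n + shift B n ∎
    where
    B = binomialS m

  absorption : ∀ k n → + n * binomialS (suc k) n ≡ + suc k * shift (binomialS k) n
  absorption zero    zero                = refl
  absorption zero    (suc zero)          = refl
  absorption zero    (suc (suc n))       = begin
    + suc (suc n) * binomialS 1 (suc (suc n))   ≡⟨ cong (+ suc (suc n) *_) (pascal 0 (suc (suc n))) ⟩
    + suc (suc n) * + 0                         ≡⟨ ℤP.*-zeroʳ (+ suc (suc n)) ⟩
    + 0                                         ∎
  absorption (suc k) zero    = sym (ℤP.*-zeroʳ (+ suc (suc k)))
  absorption (suc k) (suc n) = begin
    + suc n * B′ (suc n)
      ≡⟨ cong (+ suc n *_) (pascal (suc k) (suc n)) ⟩
    + suc n * (B (suc n) + B n)
      ≡⟨ ℤP.*-distribˡ-+ (+ suc n) (B (suc n)) (B n) ⟩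
    + suc n * B (suc n) + + suc n * B n
      ≡⟨ cong₂ _+_ (absorption k (suc n)) (cong (_* B n) (ℤP.pos-+ 1 n)) ⟩
    + suc k * C n + (+ 1 + + n) * B n
      ≡⟨ unfold (+ suc k) (C n) (+ n) (B n) ⟩
    + suc k * C n + (B n + + n * B n)
      ≡⟨ cong (λ u → + suc k * C n + (B n + u)) (absorption k n) ⟩
    + suc k * C n + (B n + + suc k * shift C n)
      ≡⟨ regroup (+ suc k) (C n) (B n) (shift C n) ⟩
    + suc k * (C n + shift C n) + B n
      ≡⟨ cong (λ u → + suc k * u + B n) (pascal k n) ⟨
    + suc k * B n + B n
      ≡⟨ fold (+ suc k) (B n) ⟩
    (+ 1 + + suc k) * B n
      ≡⟨ cong (_* B n) (ℤP.pos-+ 1 (suc k)) ⟨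
    + suc (suc k) * B n ∎
    where
    B′ = binomialS (suc (suc k))
    B = binomialS (suc k)
    C = binomialS k
    unfold : ∀ c x s y → c * x + (+ 1 + s) * y ≡ c * x + (y + s * y)
    unfold = solve-∀
    regroup : ∀ c x y z → c * x + (y + c * z) ≡ c * (x + z) + y
    regroup = solve-∀
    fold : ∀ c y → c * y + y ≡ (+ 1 + c) * y
    fold = solve-∀

  sumBelow : (ℕ → ℕ) → ℕ → ℕ
  sumBelow f zero    = 0
  sumBelow f (suc t) = sumBelow f t ℕ.+ f t

  -- Counts y ∈ ℤᵐ with ‖y‖₁ ≤ t by the head of y: 0, or ±(t ∸ j) for some j < t.
  crossCount : ℕ → ℕ → ℕ
  crossCount zero    t = 1
  crossCount (suc m) t = crossCount m t ℕ.+ 2 ℕ.* sumBelow (crossCount m) t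

  crossS : ℕ → Series
  crossS m t = + crossCount m t

  crossCount-zero : ∀ m → crossCount m 0 ≡ 1
  crossCount-zero zero    = refl
  crossCount-zero (suc m) = trans (ℕP.+-identityʳ (crossCount m 0)) (crossCount-zero m)

  crossCount-step : ∀ m n → crossCount (suc m) (suc n) ≡
                    crossCount (suc m) n ℕ.+ (crossCount m (suc n) ℕ.+ crossCount m n)
  crossCount-step m n = step (crossCount m (suc n)) (sumBelow (crossCount m) n) (crossCount m n)
    where
    step : ∀ a s b → a ℕ.+ 2 ℕ.* (s ℕ.+ b) ≡ (b ℕ.+ 2 ℕ.* s) ℕ.+ (a ℕ.+ b)
    step = ℕ-solve-∀

  Δ-crossS : ∀ m → Δ (crossS (suc m)) ≗ (crossS m +S shift (crossS m))
  Δ-crossS m zero    = trans (ℤP.+-identityʳ _) (ℤP.pos-+ (crossCount m 0) 0)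
  Δ-crossS m (suc n) = begin
    + X′ (suc n) - + X′ n                      ≡⟨ cong (λ x → + x - + X′ n) (crossCount-step m n) ⟩
    + (X′ n ℕ.+ (X (suc n) ℕ.+ X n)) - + X′ n  ≡⟨ cong (_- + X′ n) (ℤP.pos-+ (X′ n) _) ⟩
    + X′ n + + (X (suc n) ℕ.+ X n) - + X′ n    ≡⟨ cancel (+ X′ n) _ ⟩
    + (X (suc n) ℕ.+ X n)                      ≡⟨ ℤP.pos-+ (X (suc n)) (X n) ⟩
    + X (suc n) + + X n                        ∎
    where
    X = crossCount m
    X′ = crossCount (suc m)
    cancel : ∀ x y → x + y - x ≡ y
    cancel = solve-∀

  Δ^-crossS : ∀ m → Δ^ (suc m) (crossS m) ≗ binomialS m
  Δ^-crossS zero    zero    = refl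
  Δ^-crossS zero    (suc n) = refl
  Δ^-crossS (suc m) n = begin
    Δ^ (suc (suc m)) (crossS (suc m)) n
      ≡⟨ Δ^-suc (suc m) (crossS (suc m)) n ⟩
    Δ^ (suc m) (Δ (crossS (suc m))) n
      ≡⟨ Δ^-cong (suc m) (Δ-crossS m) n ⟩
    Δ^ (suc m) (crossS m +S shift (crossS m)) n
      ≡⟨ Δ^-+ (suc m) (crossS m) (shift (crossS m)) n ⟩
    Δ^ (suc m) (crossS m) n + Δ^ (suc m) (shift (crossS m)) n
      ≡⟨ cong (_+_ (Δ^ (suc m) (crossS m) n)) (Δ^-shift (suc m) (crossS m) n) ⟩
    Δ^ (suc m) (crossS m) n + shift (Δ^ (suc m) (crossS m)) n
      ≡⟨ cong₂ _+_ (Δ^-crossS m n) (shift-cong (Δ^-crossS m) n) ⟩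
    binomialS m n + shift (binomialS m) n
      ≡⟨ pascal m n ⟨
    binomialS (suc m) n ∎

  latticeCount : ℕ → ℕ → ℕ
  latticeCount m t = suc t ℕ.* crossCount m t

  ehrhartS-latticeCount : ∀ m → ehrhartS (latticeCount m) ≗ derivZ (crossS m)
  ehrhartS-latticeCount m zero    = cong (λ x → + 1 * + x) (sym (crossCount-zero m))
  ehrhartS-latticeCount m (suc n) = ℤP.pos-* (suc (suc n)) (crossCount m (suc n))

  hstarClaim≗ : ∀ k → hstarClaim (suc k) ≗ (binomialS (suc k) +S (+ (2 ℕ.* suc k) ·S shift (binomialS k)))
  hstarClaim≗ k n = cong (_+_ (binomialS (suc k) n))
    (trans (constS-*S (+ (2 ℕ.* suc k)) (zS *S binomialS k) n) (cong (+ (2 ℕ.* suc k) *_) (zS-*S (binomialS k) n)))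

  hstar-coefficient : ∀ k n →
    derivZ (Δ (binomialS (suc k))) n + + suc (suc (suc k)) * shift (binomialS (suc k)) n ≡
    binomialS (suc k) n + + (2 ℕ.* suc k) * shift (binomialS k) n
  hstar-coefficient k zero    = base (binomialS (suc k) 0) (+ suc (suc (suc k))) (+ (2 ℕ.* suc k))
    where
    base : ∀ b c d → + 1 * (b - + 0) + c * + 0 ≡ b + d * + 0
    base = solve-∀
  hstar-coefficient k (suc s) = begin
    + suc (suc s) * (b₁ - b₀) + + suc (suc (suc k)) * b₀
      ≡⟨ cong₂ (λ u v → u * (b₁ - b₀) + v * b₀) (ℤP.pos-+ 2 s) (ℤP.pos-+ 2 (suc k)) ⟩
    (+ 2 + + s) * (b₁ - b₀) + (+ 2 + K) * b₀
      ≡⟨ expand (+ s) K b₁ b₀ ⟩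
    b₁ + (+ 1 + + s) * b₁ - + s * b₀ + K * b₀
      ≡⟨ cong₂ (λ u v → b₁ + u - v + K * b₀) (trans (cong (_* b₁) (sym (ℤP.pos-+ 1 s))) (absorption k (suc s)))
                                            (absorption k s) ⟩
    b₁ + K * c₀ - K * shift C s + K * b₀
      ≡⟨ cong (λ u → b₁ + K * c₀ - K * shift C s + K * u) (pascal k s) ⟩
    b₁ + K * c₀ - K * shift C s + K * (c₀ + shift C s)
      ≡⟨ collect K b₁ c₀ (shift C s) ⟩
    b₁ + (+ 2 * K) * c₀
      ≡⟨ cong (λ u → b₁ + u * c₀) (ℤP.pos-* 2 (suc k)) ⟨
    b₁ + + (2 ℕ.* suc k) * c₀ ∎
    where
    B = binomialS (suc k)
    C = binomialS k
    b₁ = B (suc s)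
    b₀ = B s
    c₀ = C s
    K = + suc k
    expand : ∀ S K b₁ b₀ → (+ 2 + S) * (b₁ - b₀) + (+ 2 + K) * b₀ ≡ b₁ + (+ 1 + S) * b₁ - S * b₀ + K * b₀
    expand = solve-∀
    collect : ∀ K b₁ c₀ p → b₁ + K * c₀ - K * p + K * (c₀ + p) ≡ b₁ + (+ 2 * K) * c₀
    collect = solve-∀

  ehrhartS-hstar : ∀ k → ((oneMinusZ ^S (suc k ℕ.+ 2)) *S ehrhartS (latticeCount (suc k))) ≗ hstarClaim (suc k)
  ehrhartS-hstar k n = begin
    ((oneMinusZ ^S (m ℕ.+ 2)) *S E) n
      ≡⟨ oneMinusZ^-*S (m ℕ.+ 2) E n ⟩
    Δ^ (m ℕ.+ 2) E n
      ≡⟨ cong (λ j → Δ^ j E n) (ℕP.+-comm m 2) ⟩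
    Δ^ (suc (suc m)) E n
      ≡⟨ Δ^-cong (suc (suc m)) (ehrhartS-latticeCount m) n ⟩
    Δ^ (suc (suc m)) (derivZ (crossS m)) n
      ≡⟨ Δ^-derivZ (suc m) (crossS m) n ⟩
    derivZ (Δ (Δ^ (suc m) (crossS m))) n + + suc (suc m) * shift (Δ^ (suc m) (crossS m)) n
      ≡⟨ cong₂ (λ u v → + suc n * u + + suc (suc m) * v) (Δ-cong (Δ^-crossS m) n) (shift-cong (Δ^-crossS m) n) ⟩
    derivZ (Δ (binomialS m)) n + + suc (suc m) * shift (binomialS m) n
      ≡⟨ hstar-coefficient k n ⟩
    binomialS m n + + (2 ℕ.* m) * shift (binomialS k) n
      ≡⟨ hstarClaim≗ k n ⟨
    hstarClaim m n ∎
    where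
    m = suc k
    E = ehrhartS (latticeCount m)

sumV : ∀ {m} → Vec ℤ m → ℤ
sumV []       = + 0
sumV (y ∷ ys) = y ℤ.+ sumV ys

‖_‖₁ : ∀ {m} → Vec ℤ m → ℕ
‖ []     ‖₁ = 0
‖ y ∷ ys ‖₁ = ℤ.∣ y ∣ ℕ.+ ‖ ys ‖₁

module IntegerEmbedding where

  open import Data.Rational using (_+_; _≤_)
  open ℚᵘP.≃-Reasoning

  toℚ-≃ : ∀ a → ℚ.toℚᵘ (toℚ a) ℚᵘ.≃ ℚᵘ.mkℚᵘ a 0
  toℚ-≃ a = ℚP.toℚᵘ-fromℚᵘ (ℚᵘ.mkℚᵘ a 0)

  toℚ-+ : ∀ a b → toℚ (a ℤ.+ b) ≡ toℚ a + toℚ b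
  toℚ-+ a b = ℚP.toℚᵘ-injective (begin
    ℚ.toℚᵘ (toℚ (a ℤ.+ b))                  ≈⟨ toℚ-≃ (a ℤ.+ b) ⟩
    ℚᵘ.mkℚᵘ (a ℤ.+ b) 0                     ≈⟨ ℚᵘ.*≡* (denominators a b) ⟩
    ℚᵘ.mkℚᵘ a 0 ℚᵘ.+ ℚᵘ.mkℚᵘ b 0             ≈⟨ ℚᵘP.+-cong (toℚ-≃ a) (toℚ-≃ b) ⟨
    ℚ.toℚᵘ (toℚ a) ℚᵘ.+ ℚ.toℚᵘ (toℚ b)       ≈⟨ ℚP.toℚᵘ-homo-+ (toℚ a) (toℚ b) ⟨
    ℚ.toℚᵘ (toℚ a + toℚ b)                  ∎)
    where
    denominators : ∀ a b → (a ℤ.+ b) ℤ.* + 1 ≡ (a ℤ.* + 1 ℤ.+ b ℤ.* + 1) ℤ.* + 1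
    denominators = solve-∀

  toℚ-mono-≤ : ∀ {a b} → a ℤ.≤ b → toℚ a ≤ toℚ b
  toℚ-mono-≤ {a} {b} a≤b = ℚP.toℚᵘ-cancel-≤
    (ℚᵘP.≤-respˡ-≃ (ℚᵘP.≃-sym (toℚ-≃ a)) (ℚᵘP.≤-respʳ-≃ (ℚᵘP.≃-sym (toℚ-≃ b))
      (ℚᵘ.*≤* (subst₂ ℤ._≤_ (sym (ℤP.*-identityʳ a)) (sym (ℤP.*-identityʳ b)) a≤b))))

  toℚ-cancel-≤ : ∀ {a b} → toℚ a ≤ toℚ b → a ℤ.≤ b
  toℚ-cancel-≤ {a} {b} p≤q
    with ℚᵘP.≤-respˡ-≃ (toℚ-≃ a) (ℚᵘP.≤-respʳ-≃ (toℚ-≃ b) (ℚP.toℚᵘ-mono-≤ p≤q))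
  ... | ℚᵘ.*≤* a*1≤b*1 = subst₂ ℤ._≤_ (ℤP.*-identityʳ a) (ℤP.*-identityʳ b) a*1≤b*1

  toℚ-injective : ∀ {a b} → toℚ a ≡ toℚ b → a ≡ b
  toℚ-injective eq = ℤP.≤-antisym (toℚ-cancel-≤ (ℚP.≤-reflexive eq)) (toℚ-cancel-≤ (ℚP.≤-reflexive (sym eq)))

  toℚ-nonNeg : ∀ n → 0ℚ ≤ toℚ (+ n)
  toℚ-nonNeg n = toℚ-mono-≤ {+ 0} {+ n} (+≤+ z≤n)

module RationalSums where

  open import Data.Rational using (_+_; _*_; _≤_)
  open IntegerEmbedding
  open ≡-Reasoning
  private
    module Sum = SemiringSum (CommutativeRing.semiring ℚP.+-*-commutativeRing)

  sumℚ≡sum : ∀ {n} (f : Fin n → ℚ) → sumℚ f ≡ Sum.sum f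
  sumℚ≡sum {zero}  f = refl
  sumℚ≡sum {suc n} f = cong (_+_ (f zero)) (sumℚ≡sum (λ i → f (suc i)))

  sumℚ-cong : ∀ {n} {f g : Fin n → ℚ} → f ≗ g → sumℚ f ≡ sumℚ g
  sumℚ-cong {f = f} {g} f≗g = begin
    sumℚ f  ≡⟨ sumℚ≡sum f ⟩
    Sum.sum f ≡⟨ Sum.sum-cong-≗ f≗g ⟩
    Sum.sum g ≡⟨ sumℚ≡sum g ⟨
    sumℚ g  ∎

  sumℚ-+ : ∀ {n} (f g : Fin n → ℚ) → sumℚ (λ i → f i + g i) ≡ sumℚ f + sumℚ g
  sumℚ-+ f g = begin
    sumℚ (λ i → f i + g i) ≡⟨ sumℚ≡sum (λ i → f i + g i) ⟩
    Sum.sum (λ i → f i + g i) ≡⟨ Sum.∑-distrib-+ f g ⟩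
    Sum.sum f + Sum.sum g       ≡⟨ cong₂ _+_ (sumℚ≡sum f) (sumℚ≡sum g) ⟨
    sumℚ f + sumℚ g         ∎

  sumℚ-*ˡ : ∀ {n} c (f : Fin n → ℚ) → sumℚ (λ i → c * f i) ≡ c * sumℚ f
  sumℚ-*ˡ c f = begin
    sumℚ (λ i → c * f i)  ≡⟨ sumℚ≡sum (λ i → c * f i) ⟩
    Sum.sum (λ i → c * f i) ≡⟨ Sum.*-distribˡ-sum c f ⟨
    c * Sum.sum f           ≡⟨ cong (c *_) (sumℚ≡sum f) ⟨
    c * sumℚ f            ∎

  sumℚ-*ʳ : ∀ {n} c (f : Fin n → ℚ) → sumℚ (λ i → f i * c) ≡ sumℚ f * c
  sumℚ-*ʳ c f = begin
    sumℚ (λ i → f i * c)  ≡⟨ sumℚ≡sum (λ i → f i * c) ⟩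
    Sum.sum (λ i → f i * c) ≡⟨ Sum.*-distribʳ-sum c f ⟨
    Sum.sum f * c           ≡⟨ cong (_* c) (sumℚ≡sum f) ⟨
    sumℚ f * c            ∎

  sumℚ-comm : ∀ {m n} (f : Fin m → Fin n → ℚ) →
              sumℚ (λ i → sumℚ (λ j → f i j)) ≡ sumℚ (λ j → sumℚ (λ i → f i j))
  sumℚ-comm f = begin
    sumℚ (λ i → sumℚ (λ j → f i j))   ≡⟨ sumℚ-cong (λ i → sumℚ≡sum (f i)) ⟩
    sumℚ (λ i → Sum.sum (λ j → f i j))  ≡⟨ sumℚ≡sum (λ i → Sum.sum (λ j → f i j)) ⟩
    Sum.sum (λ i → Sum.sum (λ j → f i j)) ≡⟨ Sum.∑-comm f ⟩
    Sum.sum (λ j → Sum.sum (λ i → f i j)) ≡⟨ sumℚ≡sum (λ j → Sum.sum (λ i → f i j)) ⟨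
    sumℚ (λ j → Sum.sum (λ i → f i j))  ≡⟨ sumℚ-cong (λ j → sumℚ≡sum (λ i → f i j)) ⟨
    sumℚ (λ j → sumℚ (λ i → f i j))   ∎

  sumℚ-zero : ∀ n → sumℚ {n} (λ _ → 0ℚ) ≡ 0ℚ
  sumℚ-zero zero    = refl
  sumℚ-zero (suc n) = cong (_+_ 0ℚ) (sumℚ-zero n)

  sumℚ-single : ∀ {n} (f : Fin n → ℚ) i → (∀ j → j ≢ i → f j ≡ 0ℚ) → sumℚ f ≡ f i
  sumℚ-single {suc n} f zero    f≡0 = begin
    f zero + sumℚ (λ j → f (suc j)) ≡⟨ cong (_+_ (f zero)) (sumℚ-cong (λ j → f≡0 (suc j) (λ ()))) ⟩
    f zero + sumℚ {n} (λ _ → 0ℚ)    ≡⟨ cong (_+_ (f zero)) (sumℚ-zero n) ⟩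
    f zero + 0ℚ                     ≡⟨ ℚP.+-identityʳ (f zero) ⟩
    f zero                          ∎
  sumℚ-single {suc n} f (suc i) f≡0 = begin
    f zero + sumℚ (λ j → f (suc j))
      ≡⟨ cong₂ _+_ (f≡0 zero (λ ())) (sumℚ-single (λ j → f (suc j)) i λ j j≢i → f≡0 (suc j) (j≢i ∘ suc-injective)) ⟩
    0ℚ + f (suc i)
      ≡⟨ ℚP.+-identityˡ (f (suc i)) ⟩
    f (suc i) ∎

  sumℚ-mono-≤ : ∀ {n} {f g : Fin n → ℚ} → (∀ i → f i ≤ g i) → sumℚ f ≤ sumℚ g
  sumℚ-mono-≤ {zero}  f≤g = ℚP.≤-refl
  sumℚ-mono-≤ {suc n} f≤g = ℚP.+-mono-≤ (f≤g zero) (sumℚ-mono-≤ (λ i → f≤g (suc i)))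

  sumℚ-nonNeg : ∀ {n} {f : Fin n → ℚ} → (∀ i → 0ℚ ≤ f i) → 0ℚ ≤ sumℚ f
  sumℚ-nonNeg {n} {f} 0≤f = subst (_≤ sumℚ f) (sumℚ-zero n) (sumℚ-mono-≤ 0≤f)

  sumℚ-toℚ : ∀ {m} (y : Vec ℤ m) → sumℚ (λ g → toℚ (lookup y g)) ≡ toℚ (sumV y)
  sumℚ-toℚ []       = refl
  sumℚ-toℚ (y ∷ ys) = trans (cong (_+_ (toℚ y)) (sumℚ-toℚ ys)) (sym (toℚ-+ y (sumV ys)))

  sumℚ-toℚ-∣∣ : ∀ {m} (y : Vec ℤ m) → sumℚ (λ g → toℚ (+ ℤ.∣ lookup y g ∣)) ≡ toℚ (+ ‖ y ‖₁)
  sumℚ-toℚ-∣∣ []       = refl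
  sumℚ-toℚ-∣∣ (y ∷ ys) = begin
    toℚ (+ ℤ.∣ y ∣) + sumℚ (λ g → toℚ (+ ℤ.∣ lookup ys g ∣)) ≡⟨ cong (_+_ (toℚ (+ ℤ.∣ y ∣))) (sumℚ-toℚ-∣∣ ys) ⟩
    toℚ (+ ℤ.∣ y ∣) + toℚ (+ ‖ ys ‖₁)                      ≡⟨ toℚ-+ (+ ℤ.∣ y ∣) (+ ‖ ys ‖₁) ⟨
    toℚ (+ ℤ.∣ y ∣ ℤ.+ + ‖ ys ‖₁)                          ≡⟨ cong toℚ (ℤP.pos-+ ℤ.∣ y ∣ ‖ ys ‖₁) ⟨
    toℚ (+ ‖ y ∷ ys ‖₁)                                    ∎

module RationalInequalities where

  open import Data.Rational using (_+_; _*_; -_; _-_; _≤_)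
  open +-*-Solver using (solve; _:=_; _:+_; _:*_; _:-_; :-_)
  open ≡-Reasoning

  ≤-+-nonNeg : ∀ {p q} s → 0ℚ ≤ s → q ≡ p + s → p ≤ q
  ≤-+-nonNeg {p} s 0≤s q≡p+s = subst₂ _≤_ (ℚP.+-identityʳ p) (sym q≡p+s) (ℚP.+-monoʳ-≤ p 0≤s)

  ≤⇒0≤- : ∀ {p q} → p ≤ q → 0ℚ ≤ q - p
  ≤⇒0≤- {p} {q} p≤q = subst (_≤ q - p) (ℚP.+-inverseʳ p) (ℚP.+-monoˡ-≤ (- p) p≤q)

  0≤* : ∀ {p q} → 0ℚ ≤ p → 0ℚ ≤ q → 0ℚ ≤ p * q
  0≤* {p} {q} 0≤p 0≤q =
    ℚP.nonNegative⁻¹ (p * q) {{ℚP.nonNeg*nonNeg⇒nonNeg p {{ℚ.nonNegative 0≤p}} q {{ℚ.nonNegative 0≤q}}}}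

  toℚ-∣∣-≤ : ∀ z {s} → toℚ z ≤ s → - toℚ z ≤ s → toℚ (+ ℤ.∣ z ∣) ≤ s
  toℚ-∣∣-≤ (+ n)    z≤s  _    = z≤s
  toℚ-∣∣-≤ -[1+ n ] _    -z≤s = subst (_≤ _) (neg-involutive (toℚ (+ suc n))) -z≤s
    where
    neg-involutive : ∀ x → - (- x) ≡ x
    neg-involutive = solve 1 (λ x → :- (:- x) := x) refl

  splitRatio : ∀ {u v} → 0ℚ ≤ u → 0ℚ ≤ v → ∃[ q ] 0ℚ ≤ q × 0ℚ ≤ 1ℚ - q × q * (u + v) ≡ v
  splitRatio {u} {v} 0≤u 0≤v with u + v ℚP.≟ 0ℚ
  ... | yes u+v≡0 = 0ℚ , ℚP.≤-refl , ℚP.nonNegative⁻¹ 1ℚ , trans (ℚP.*-zeroˡ (u + v)) (sym v≡0)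
    where
    v≡0 : v ≡ 0ℚ
    v≡0 = ℚP.≤-antisym (≤-+-nonNeg u 0≤u (trans (sym u+v≡0) (ℚP.+-comm u v))) 0≤v
  ... | no u+v≢0 = v * r , 0≤* 0≤v 0≤r , subst (0ℚ ≤_) (sym 1-q≡u*r) (0≤* 0≤u 0≤r) , q*[u+v]≡v
    where
    instance
      u+v≢0ℚ : ℚ.NonZero (u + v)
      u+v≢0ℚ = ℚ.≢-nonZero u+v≢0
    r = 1/ (u + v)
    0≤r : 0ℚ ≤ r
    0≤r = ℚP.nonNegative⁻¹ r {{ℚP.pos⇒nonNeg r {{r>0}}}}
      where
      u+v>0 : ℚ.Positive (u + v)
      u+v>0 = ℚP.nonNeg∧nonZero⇒pos (u + v) {{ℚ.nonNegative (ℚP.+-mono-≤ 0≤u 0≤v)}}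
      r>0 : ℚ.Positive r
      r>0 = ℚP.1/pos⇒pos (u + v) {{u+v>0}}
    q*[u+v]≡v : v * r * (u + v) ≡ v
    q*[u+v]≡v = begin
      v * r * (u + v)   ≡⟨ ℚP.*-assoc v r (u + v) ⟩
      v * (r * (u + v)) ≡⟨ cong (v *_) (ℚP.*-inverseˡ (u + v)) ⟩
      v * 1ℚ            ≡⟨ ℚP.*-identityʳ v ⟩
      v                 ∎
    1-q≡u*r : 1ℚ - v * r ≡ u * r
    1-q≡u*r = begin
      1ℚ - v * r              ≡⟨ cong (_- v * r) (ℚP.*-inverseˡ (u + v)) ⟨
      r * (u + v) - v * r     ≡⟨ cancel u v r ⟩
      u * r                   ∎
      where
      cancel : ∀ u v r → r * (u + v) - v * r ≡ u * r
      cancel = solve 3 (λ u v r → r :* (u :+ v) :- v :* r := u :* r) refl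

module Coordinates {m} (c : Fin m → Fin 3 → ℚ) where

  open import Data.Rational using (_+_; _*_; -_; _-_; _≤_)
  open +-*-Solver using (solve; _:=_; _:+_; _:*_; _:-_; :-_; con)
  open RationalSums
  open RationalInequalities
  open ≡-Reasoning

  weight : Fin 3 → ℚ
  weight k = sumℚ (λ f → c f k)

  A B D : ℚ
  A = weight zero
  B = weight (suc zero)
  D = weight (suc (suc zero))

  combination : ∀ (γ : Fin 3 → ℚ) → sumℚ (λ f → sumℚ (λ k → c f k * γ k)) ≡ sumℚ (λ k → weight k * γ k)
  combination γ = trans (sumℚ-comm (λ f k → c f k * γ k)) (sumℚ-cong (λ k → sumℚ-*ʳ (γ k) (λ f → c f k)))

  total-coordinate : sumℚ (λ f → sumℚ (λ k → c f k)) ≡ A + B + D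
  total-coordinate = trans (sumℚ-comm c) (regroup A B D)
    where
    regroup : ∀ a b d → a + (b + (d + 0ℚ)) ≡ a + b + d
    regroup = solve 3 (λ a b d → a :+ (b :+ (d :+ con 0ℚ)) := a :+ b :+ d) refl

  -- genV ignores its edge argument, so the edge of I₁ stands for every edge.
  vertex₁-coordinate : sumℚ (λ f → sumℚ (λ k → c f k * genV f k zero)) ≡ A + B - D
  vertex₁-coordinate = trans (combination (λ k → genV {1} zero k zero)) (regroup A B D)
    where
    regroup : ∀ a b d → a * 1ℚ + (b * 1ℚ + (d * - 1ℚ + 0ℚ)) ≡ a + b - d
    regroup = solve 3 (λ a b d → a :* con 1ℚ :+ (b :* con 1ℚ :+ (d :* :- con 1ℚ :+ con 0ℚ)) := a :+ b :- d) refl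

  vertex₂-coordinate : sumℚ (λ f → sumℚ (λ k → c f k * genV f k (suc zero))) ≡ A - B + D
  vertex₂-coordinate = trans (combination (λ k → genV {1} zero k (suc zero))) (regroup A B D)
    where
    regroup : ∀ a b d → a * 1ℚ + (b * - 1ℚ + (d * 1ℚ + 0ℚ)) ≡ a - b + d
    regroup = solve 3 (λ a b d → a :* con 1ℚ :+ (b :* :- con 1ℚ :+ (d :* con 1ℚ :+ con 0ℚ)) := a :- b :+ d) refl

  edge-coordinate : ∀ g → sumℚ (λ f → sumℚ (λ k → c f k * genE f k g)) ≡ sumℚ (λ k → c g k * edgeSign k)
  edge-coordinate g = begin
    sumℚ (λ f → sumℚ (λ k → c f k * genE f k g))
      ≡⟨ sumℚ-single (λ f → sumℚ (λ k → c f k * genE f k g)) g off-g ⟩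
    sumℚ (λ k → c g k * genE g k g)
      ≡⟨ sumℚ-cong (λ k → cong (c g k *_) (genE-diagonal k)) ⟩
    sumℚ (λ k → c g k * edgeSign k) ∎
    where
    genE-diagonal : ∀ k → genE g k g ≡ edgeSign k
    genE-diagonal k with g Fin.≟ g
    ... | yes _   = refl
    ... | no g≢g  = ⊥-elim (g≢g refl)
    genE-off : ∀ {f} k → f ≢ g → genE f k g ≡ 0ℚ
    genE-off {f} k f≢g with f Fin.≟ g
    ... | yes f≡g = ⊥-elim (f≢g f≡g)
    ... | no _    = refl
    off-g : ∀ f → f ≢ g → sumℚ (λ k → c f k * genE f k g) ≡ 0ℚ
    off-g f f≢g = trans (sumℚ-cong (λ k → trans (cong (c f k *_) (genE-off k f≢g)) (ℚP.*-zeroʳ (c f k))))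
                        (sumℚ-zero 3)

  edge-coordinates-sum : sumℚ (λ g → sumℚ (λ k → c g k * edgeSign k)) ≡ - A + B + D
  edge-coordinates-sum = trans (combination edgeSign) (regroup A B D)
    where
    regroup : ∀ a b d → a * - 1ℚ + (b * 1ℚ + (d * 1ℚ + 0ℚ)) ≡ - a + b + d
    regroup = solve 3 (λ a b d → a :* :- con 1ℚ :+ (b :* con 1ℚ :+ (d :* con 1ℚ :+ con 0ℚ)) := :- a :+ b :+ d) refl

  module _ (c≥0 : ∀ f k → 0ℚ ≤ c f k) where

    weight-nonNeg : ∀ k → 0ℚ ≤ weight k
    weight-nonNeg k = sumℚ-nonNeg (λ f → c≥0 f k)

    vertex₁≤total : A + B - D ≤ A + B + D
    vertex₁≤total = ≤-+-nonNeg (D + D) (ℚP.+-mono-≤ (weight-nonNeg _) (weight-nonNeg _)) (gap A B D)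
      where
      gap : ∀ a b d → a + b + d ≡ (a + b - d) + (d + d)
      gap = solve 3 (λ a b d → a :+ b :+ d := (a :+ b :- d) :+ (d :+ d)) refl

    vertex₂≤total : A - B + D ≤ A + B + D
    vertex₂≤total = ≤-+-nonNeg (B + B) (ℚP.+-mono-≤ (weight-nonNeg _) (weight-nonNeg _)) (gap A B D)
      where
      gap : ∀ a b d → a + b + d ≡ (a - b + d) + (b + b)
      gap = solve 3 (λ a b d → a :+ b :+ d := (a :- b :+ d) :+ (b :+ b)) refl

    ∣edge∣≤ : ∀ g z → toℚ z ≡ sumℚ (λ k → c g k * edgeSign k) → toℚ (+ ℤ.∣ z ∣) ≤ sumℚ (λ k → c g k)
    ∣edge∣≤ g z z≡ = toℚ-∣∣-≤ z
      (≤-+-nonNeg (a + a) (ℚP.+-mono-≤ (c≥0 g _) (c≥0 g _)) (trans (gap₁ a b d) (cong (_+ (a + a)) (sym z≡))))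
      (≤-+-nonNeg ((b + b) + (d + d)) (ℚP.+-mono-≤ (ℚP.+-mono-≤ (c≥0 g _) (c≥0 g _)) (ℚP.+-mono-≤ (c≥0 g _) (c≥0 g _)))
        (trans (gap₂ a b d) (cong (λ e → - e + ((b + b) + (d + d))) (sym z≡))))
      where
      a = c g zero
      b = c g (suc zero)
      d = c g (suc (suc zero))
      gap₁ : ∀ a b d → a + (b + (d + 0ℚ)) ≡ (a * - 1ℚ + (b * 1ℚ + (d * 1ℚ + 0ℚ))) + (a + a)
      gap₁ = solve 3 (λ a b d → a :+ (b :+ (d :+ con 0ℚ))
                             := (a :* :- con 1ℚ :+ (b :* con 1ℚ :+ (d :* con 1ℚ :+ con 0ℚ))) :+ (a :+ a)) refl
      gap₂ : ∀ a b d → a + (b + (d + 0ℚ)) ≡ - (a * - 1ℚ + (b * 1ℚ + (d * 1ℚ + 0ℚ))) + ((b + b) + (d + d))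
      gap₂ = solve 3 (λ a b d → a :+ (b :+ (d :+ con 0ℚ))
                             := :- (a :* :- con 1ℚ :+ (b :* con 1ℚ :+ (d :* con 1ℚ :+ con 0ℚ))) :+ ((b :+ b) :+ (d :+ d))) refl

InDilateH : ∀ {m} → ℕ → ℤPoint m → Set
InDilateH t ((x₁ ∷ x₂ ∷ []) , y) =
  x₁ ℤ.≤ + t × x₂ ℤ.≤ + t × x₁ ℤ.+ x₂ ℤ.+ sumV y ≡ + t × ‖ y ‖₁ ℕ.≤ t

module HDescription where

  open import Data.Rational using (_+_; _*_; -_; _-_; _≤_)
  open +-*-Solver using (solve; _:=_; _:+_; _:*_; _:-_; :-_; con)

  open IntegerEmbedding
  open RationalSums
  open RationalInequalities
  open ≡-Reasoning

  inDilate⇒H : ∀ {m} t (p : ℤPoint m) → InDilate m t p → InDilateH t p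
  inDilate⇒H t ((x₁ ∷ x₂ ∷ []) , y) (c , c≥0 , Σc≡t , vertices , edges) =
    toℚ-cancel-≤ x₁≤t , toℚ-cancel-≤ x₂≤t , toℚ-injective sum≡t , ℤP.drop‿+≤+ (toℚ-cancel-≤ ‖y‖≤t)
    where
    open Coordinates c
    t≡ : toℚ (+ t) ≡ A + B + D
    t≡ = trans (sym Σc≡t) total-coordinate
    x₁≡ : toℚ x₁ ≡ A + B - D
    x₁≡ = trans (sym (vertices zero)) vertex₁-coordinate
    x₂≡ : toℚ x₂ ≡ A - B + D
    x₂≡ = trans (sym (vertices (suc zero))) vertex₂-coordinate
    y≡ : ∀ g → toℚ (lookup y g) ≡ sumℚ (λ k → c g k * edgeSign k)
    y≡ g = trans (sym (edges g)) (edge-coordinate g)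
    x₁≤t : toℚ x₁ ≤ toℚ (+ t)
    x₁≤t = subst₂ _≤_ (sym x₁≡) (sym t≡) (vertex₁≤total c≥0)
    x₂≤t : toℚ x₂ ≤ toℚ (+ t)
    x₂≤t = subst₂ _≤_ (sym x₂≡) (sym t≡) (vertex₂≤total c≥0)
    sum≡t : toℚ (x₁ ℤ.+ x₂ ℤ.+ sumV y) ≡ toℚ (+ t)
    sum≡t = begin
      toℚ (x₁ ℤ.+ x₂ ℤ.+ sumV y)
        ≡⟨ trans (toℚ-+ (x₁ ℤ.+ x₂) (sumV y)) (cong (_+ toℚ (sumV y)) (toℚ-+ x₁ x₂)) ⟩
      toℚ x₁ + toℚ x₂ + toℚ (sumV y)
        ≡⟨ cong₂ _+_ (cong₂ _+_ x₁≡ x₂≡) (trans (sym (sumℚ-toℚ y)) (trans (sumℚ-cong y≡) edge-coordinates-sum)) ⟩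
      (A + B - D) + (A - B + D) + (- A + B + D)
        ≡⟨ collect A B D ⟩
      A + B + D
        ≡⟨ t≡ ⟨
      toℚ (+ t) ∎
      where
      collect : ∀ a b d → (a + b - d) + (a - b + d) + (- a + b + d) ≡ a + b + d
      collect = solve 3 (λ a b d → (a :+ b :- d) :+ (a :- b :+ d) :+ (:- a :+ b :+ d) := a :+ b :+ d) refl
    ‖y‖≤t : toℚ (+ ‖ y ‖₁) ≤ toℚ (+ t)
    ‖y‖≤t = subst₂ _≤_ (sumℚ-toℚ-∣∣ y) Σc≡t (sumℚ-mono-≤ (λ g → ∣edge∣≤ c≥0 g (lookup y g) (y≡ g)))

  positivePart negativePart : ℤ → ℕ
  positivePart (+ n)    = n
  positivePart -[1+ n ] = 0
  negativePart (+ n)    = 0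
  negativePart -[1+ n ] = suc n

  positivePart≡ : ∀ z → + positivePart z ≡ z ℤ.+ + negativePart z
  positivePart≡ (+ n)    = sym (ℤP.+-identityʳ (+ n))
  positivePart≡ -[1+ n ] = sym (ℤP.n⊖n≡0 (suc n))

  ∣∣≡positivePart+negativePart : ∀ z → ℤ.∣ z ∣ ≡ positivePart z ℕ.+ negativePart z
  ∣∣≡positivePart+negativePart (+ n)    = sym (ℕP.+-identityʳ n)
  ∣∣≡positivePart+negativePart -[1+ n ] = refl

  module SignParts {m} (y : Vec ℤ m) where

    P N : Fin m → ℚ
    P g = toℚ (+ positivePart (lookup y g))
    N g = toℚ (+ negativePart (lookup y g))

    P≡y+N : ∀ g → P g ≡ toℚ (lookup y g) + N g
    P≡y+N g = trans (cong toℚ (positivePart≡ (lookup y g))) (toℚ-+ (lookup y g) _)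

    ΣP≡ : sumℚ P ≡ toℚ (sumV y) + sumℚ N
    ΣP≡ = begin
      sumℚ P                                  ≡⟨ sumℚ-cong P≡y+N ⟩
      sumℚ (λ g → toℚ (lookup y g) + N g)     ≡⟨ sumℚ-+ _ N ⟩
      sumℚ (λ g → toℚ (lookup y g)) + sumℚ N  ≡⟨ cong (_+ sumℚ N) (sumℚ-toℚ y) ⟩
      toℚ (sumV y) + sumℚ N                   ∎

    ‖‖₁≡ : toℚ (+ ‖ y ‖₁) ≡ sumℚ P + sumℚ N
    ‖‖₁≡ = begin
      toℚ (+ ‖ y ‖₁)                             ≡⟨ sumℚ-toℚ-∣∣ y ⟨
      sumℚ (λ g → toℚ (+ ℤ.∣ lookup y g ∣))     ≡⟨ sumℚ-cong ∣y∣≡P+N ⟩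
      sumℚ (λ g → P g + N g)                    ≡⟨ sumℚ-+ P N ⟩
      sumℚ P + sumℚ N                           ∎
      where
      ∣y∣≡P+N : ∀ g → toℚ (+ ℤ.∣ lookup y g ∣) ≡ P g + N g
      ∣y∣≡P+N g = begin
        toℚ (+ ℤ.∣ lookup y g ∣)        ≡⟨ cong (toℚ ∘ +_) (∣∣≡positivePart+negativePart (lookup y g)) ⟩
        toℚ (+ (p ℕ.+ n))               ≡⟨ cong toℚ (ℤP.pos-+ p n) ⟩
        toℚ (+ p ℤ.+ + n)               ≡⟨ toℚ-+ (+ p) (+ n) ⟩
        P g + N g                       ∎
        where
        p = positivePart (lookup y g)
        n = negativePart (lookup y g)

  split-coordinates : ∀ {A W T X₁ X₂} q →
    A + W ≡ T → W + W ≡ (T - X₁) + (T - X₂) → q * ((T - X₁) + (T - X₂)) ≡ T - X₂ →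
    (A + q * W + (1ℚ - q) * W ≡ T) × (A + q * W - (1ℚ - q) * W ≡ X₁) × (A - q * W + (1ℚ - q) * W ≡ X₂)
  split-coordinates {A} {W} {T} {X₁} {X₂} q A+W≡T 2W≡U+V hq = total , vertex₁ , vertex₂
    where
    UV = (T - X₁) + (T - X₂)
    total : A + q * W + (1ℚ - q) * W ≡ T
    total = trans (merge A W q) A+W≡T
      where
      merge : ∀ a w q → a + q * w + (1ℚ - q) * w ≡ a + w
      merge = solve 3 (λ a w q → a :+ q :* w :+ (con 1ℚ :- q) :* w := a :+ w) refl
    vertex₁ : A + q * W - (1ℚ - q) * W ≡ X₁
    vertex₁ = begin
      A + q * W - (1ℚ - q) * W         ≡⟨ expand A W q ⟩
      (A + W) - (W + W) + q * (W + W)  ≡⟨ cong₂ (λ u v → u - v + q * v) A+W≡T 2W≡U+V ⟩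
      T - UV + q * UV                  ≡⟨ cong (_+_ (T - UV)) hq ⟩
      T - UV + (T - X₂)                ≡⟨ collapse T X₁ X₂ ⟩
      X₁                               ∎
      where
      expand : ∀ a w q → a + q * w - (1ℚ - q) * w ≡ (a + w) - (w + w) + q * (w + w)
      expand = solve 3 (λ a w q → a :+ q :* w :- (con 1ℚ :- q) :* w := (a :+ w) :- (w :+ w) :+ q :* (w :+ w)) refl
      collapse : ∀ t x₁ x₂ → t - ((t - x₁) + (t - x₂)) + (t - x₂) ≡ x₁
      collapse = solve 3 (λ t x₁ x₂ → t :- ((t :- x₁) :+ (t :- x₂)) :+ (t :- x₂) := x₁) refl
    vertex₂ : A - q * W + (1ℚ - q) * W ≡ X₂
    vertex₂ = begin
      A - q * W + (1ℚ - q) * W  ≡⟨ expand A W q ⟩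
      (A + W) - q * (W + W)     ≡⟨ cong₂ (λ u v → u - q * v) A+W≡T 2W≡U+V ⟩
      T - q * UV                ≡⟨ cong (_-_ T) hq ⟩
      T - (T - X₂)              ≡⟨ collapse T X₂ ⟩
      X₂                        ∎
      where
      expand : ∀ a w q → a - q * w + (1ℚ - q) * w ≡ (a + w) - q * (w + w)
      expand = solve 3 (λ a w q → a :- q :* w :+ (con 1ℚ :- q) :* w := (a :+ w) :- q :* (w :+ w)) refl
      collapse : ∀ t x → t - (t - x) ≡ x
      collapse = solve 2 (λ t x → t :- (t :- x) := x) refl

  module Splitting {m} (a w : Fin m → ℚ) (q : ℚ) where

    open RationalSums

    coefficients : Fin m → Fin 3 → ℚ
    coefficients g zero             = a g
    coefficients g (suc zero)       = q * w g
    coefficients g (suc (suc zero)) = (1ℚ - q) * w g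

    open Coordinates coefficients public using (A; B; D)

    B≡ : B ≡ q * sumℚ w
    B≡ = sumℚ-*ˡ q w

    D≡ : D ≡ (1ℚ - q) * sumℚ w
    D≡ = sumℚ-*ˡ (1ℚ - q) w

    coefficients-nonNeg : (∀ g → 0ℚ ≤ a g) → (∀ g → 0ℚ ≤ w g) → 0ℚ ≤ q → 0ℚ ≤ 1ℚ - q →
                          ∀ g k → 0ℚ ≤ coefficients g k
    coefficients-nonNeg 0≤a 0≤w 0≤q 0≤1-q g zero             = 0≤a g
    coefficients-nonNeg 0≤a 0≤w 0≤q 0≤1-q g (suc zero)       = RationalInequalities.0≤* 0≤q (0≤w g)
    coefficients-nonNeg 0≤a 0≤w 0≤q 0≤1-q g (suc (suc zero)) = RationalInequalities.0≤* 0≤1-q (0≤w g)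

    edge-coefficients : ∀ g → sumℚ (λ k → coefficients g k * edgeSign k) ≡ w g - a g
    edge-coefficients g = simplify (a g) (w g) q
      where
      simplify : ∀ a w q → a * - 1ℚ + (q * w * 1ℚ + ((1ℚ - q) * w * 1ℚ + 0ℚ)) ≡ w - a
      simplify = solve 3 (λ a w q → a :* :- con 1ℚ :+ (q :* w :* con 1ℚ :+ ((con 1ℚ :- q) :* w :* con 1ℚ :+ con 0ℚ))
                                 := w :- a) refl

  inDilate-from-split : ∀ {m} t x₁ x₂ (y : Vec ℤ m) (a w : Fin m → ℚ) →
    (∀ g → 0ℚ ≤ a g) → (∀ g → 0ℚ ≤ w g) → x₁ ℤ.≤ + t → x₂ ℤ.≤ + t →
    let T = toℚ (+ t) ; X₁ = toℚ x₁ ; X₂ = toℚ x₂ in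
    sumℚ a + sumℚ w ≡ T → sumℚ w + sumℚ w ≡ (T - X₁) + (T - X₂) →
    (∀ g → w g - a g ≡ toℚ (lookup y g)) →
    InDilate m t ((x₁ ∷ x₂ ∷ []) , y)
  inDilate-from-split t x₁ x₂ y a w 0≤a 0≤w x₁≤t x₂≤t Σa+Σw≡t 2Σw≡U+V w-a≡y =
    coefficients , coefficients-nonNeg 0≤a 0≤w 0≤q 0≤1-q , total , vertices , edges
    where
    ratio = splitRatio (≤⇒0≤- (toℚ-mono-≤ x₁≤t)) (≤⇒0≤- (toℚ-mono-≤ x₂≤t))
    q = proj₁ ratio
    0≤q = proj₁ (proj₂ ratio)
    0≤1-q = proj₁ (proj₂ (proj₂ ratio))
    open Splitting a w q
    open Coordinates coefficients using (total-coordinate; vertex₁-coordinate; vertex₂-coordinate; edge-coordinate)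
    coordinates = split-coordinates {A = sumℚ a} {W = sumℚ w} q Σa+Σw≡t 2Σw≡U+V
                                    (proj₂ (proj₂ (proj₂ ratio)))
    total : sumℚ (λ f → sumℚ (λ k → coefficients f k)) ≡ toℚ (+ t)
    total = trans total-coordinate (trans (cong₂ (λ b d → A + b + d) B≡ D≡) (proj₁ coordinates))
    vertices : ∀ i → sumℚ (λ f → sumℚ (λ k → coefficients f k * genV f k i)) ≡ toℚ (lookup (x₁ ∷ x₂ ∷ []) i)
    vertices zero       = trans vertex₁-coordinate (trans (cong₂ (λ b d → A + b - d) B≡ D≡) (proj₁ (proj₂ coordinates)))
    vertices (suc zero) = trans vertex₂-coordinate (trans (cong₂ (λ b d → A - b + d) B≡ D≡) (proj₂ (proj₂ coordinates)))
    edges : ∀ g → sumℚ (λ f → sumℚ (λ k → coefficients f k * genE f k g)) ≡ toℚ (lookup y g)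
    edges g = trans (edge-coordinate g) (trans (edge-coefficients g) (w-a≡y g))

  module Slacked {m} (t : ℕ) (y : Vec ℤ (suc m)) (‖y‖≤t : ‖ y ‖₁ ℕ.≤ t) where

    open SignParts y public

    R : ℚ
    R = toℚ (+ t) - (sumℚ P + sumℚ N)

    -- Half the slack R = t − ‖y‖₁ raises both a and w on edge zero, which exists as m ≥ 1.
    slack : Fin (suc m) → ℚ
    slack zero    = ½ * R
    slack (suc _) = 0ℚ

    a w : Fin (suc m) → ℚ
    a g = N g + slack g
    w g = P g + slack g

    0≤slack : ∀ g → 0ℚ ≤ slack g
    0≤slack zero    = 0≤* (ℚP.nonNegative⁻¹ ½) (≤⇒0≤- (subst (_≤ toℚ (+ t)) ‖‖₁≡ (toℚ-mono-≤ (+≤+ ‖y‖≤t))))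
    0≤slack (suc _) = ℚP.≤-refl

    0≤a : ∀ g → 0ℚ ≤ a g
    0≤a g = ℚP.+-mono-≤ (toℚ-nonNeg (negativePart (lookup y g))) (0≤slack g)

    0≤w : ∀ g → 0ℚ ≤ w g
    0≤w g = ℚP.+-mono-≤ (toℚ-nonNeg (positivePart (lookup y g))) (0≤slack g)

    Σslack : sumℚ slack ≡ ½ * R
    Σslack = sumℚ-single slack zero λ { zero 0≢0 → ⊥-elim (0≢0 refl) ; (suc _) _ → refl }

    Σa : sumℚ a ≡ sumℚ N + ½ * R
    Σa = trans (sumℚ-+ N slack) (cong (_+_ (sumℚ N)) Σslack)

    Σw : sumℚ w ≡ sumℚ P + ½ * R
    Σw = trans (sumℚ-+ P slack) (cong (_+_ (sumℚ P)) Σslack)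

    Σa+Σw≡t : sumℚ a + sumℚ w ≡ toℚ (+ t)
    Σa+Σw≡t = trans (cong₂ _+_ Σa Σw) (fill (sumℚ N) (sumℚ P) (toℚ (+ t)))
      where
      fill : ∀ n p t → (n + ½ * (t - (p + n))) + (p + ½ * (t - (p + n))) ≡ t
      fill = solve 3 (λ n p t → (n :+ con ½ :* (t :- (p :+ n))) :+ (p :+ con ½ :* (t :- (p :+ n))) := t) refl

    w-a≡y : ∀ g → w g - a g ≡ toℚ (lookup y g)
    w-a≡y g = begin
      (P g + slack g) - (N g + slack g)   ≡⟨ cancel (P g) (N g) (slack g) ⟩
      P g - N g                           ≡⟨ cong (_- N g) (P≡y+N g) ⟩
      (toℚ (lookup y g) + N g) - N g      ≡⟨ cancelʳ (toℚ (lookup y g)) (N g) ⟩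
      toℚ (lookup y g)                    ∎
      where
      cancel : ∀ p n s → (p + s) - (n + s) ≡ p - n
      cancel = solve 3 (λ p n s → (p :+ s) :- (n :+ s) := p :- n) refl
      cancelʳ : ∀ x n → (x + n) - n ≡ x
      cancelʳ = solve 2 (λ x n → (x :+ n) :- n := x) refl

  H⇒inDilate : ∀ {m} t (p : ℤPoint (suc m)) → InDilateH t p → InDilate (suc m) t p
  H⇒inDilate t ((x₁ ∷ x₂ ∷ []) , y) (x₁≤t , x₂≤t , sum≡t , ‖y‖≤t) =
    inDilate-from-split t x₁ x₂ y a w 0≤a 0≤w x₁≤t x₂≤t Σa+Σw≡t 2Σw≡U+V w-a≡y
    where
    open Slacked t y ‖y‖≤t
    T = toℚ (+ t)
    S = toℚ (sumV y)
    T≡ : T ≡ toℚ x₁ + toℚ x₂ + S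
    T≡ = trans (cong toℚ (sym sum≡t)) (trans (toℚ-+ (x₁ ℤ.+ x₂) (sumV y)) (cong (_+ S) (toℚ-+ x₁ x₂)))
    2Σw≡U+V : sumℚ w + sumℚ w ≡ (T - toℚ x₁) + (T - toℚ x₂)
    2Σw≡U+V = begin
      sumℚ w + sumℚ w                      ≡⟨ cong₂ _+_ Σw Σw ⟩
      (sumℚ P + ½ * R) + (sumℚ P + ½ * R)  ≡⟨ fill (sumℚ P) (sumℚ N) T ⟩
      (sumℚ P - sumℚ N) + T                ≡⟨ cong (λ p → (p - sumℚ N) + T) ΣP≡ ⟩
      (S + sumℚ N - sumℚ N) + T            ≡⟨ balance (toℚ x₁) (toℚ x₂) S (sumℚ N) T≡ ⟩
      (T - toℚ x₁) + (T - toℚ x₂)          ∎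
      where
      fill : ∀ p n t → (p + ½ * (t - (p + n))) + (p + ½ * (t - (p + n))) ≡ (p - n) + t
      fill = solve 3 (λ p n t → (p :+ con ½ :* (t :- (p :+ n))) :+ (p :+ con ½ :* (t :- (p :+ n))) := (p :- n) :+ t) refl
      balance : ∀ {t} x₁ x₂ s n → t ≡ x₁ + x₂ + s → (s + n - n) + t ≡ (t - x₁) + (t - x₂)
      balance x₁ x₂ s n refl = identity x₁ x₂ s n
        where
        identity : ∀ x₁ x₂ s n → (s + n - n) + (x₁ + x₂ + s) ≡ ((x₁ + x₂ + s) - x₁) + ((x₁ + x₂ + s) - x₂)
        identity = solve 4 (λ x₁ x₂ s n → (s :+ n :- n) :+ (x₁ :+ x₂ :+ s)
                                        := ((x₁ :+ x₂ :+ s) :- x₁) :+ ((x₁ :+ x₂ :+ s) :- x₂)) refl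

module Enumeration where

  open import Data.Integer using (_+_; _*_; -_; _-_)
  open PowerSeries using (sumBelow; crossCount; latticeCount)
  open HDescription using (inDilate⇒H; H⇒inDilate)
  open ≡-Reasoning

  tail-bound : ∀ {a b t} → a ℕ.+ b ℕ.≤ t → b ℕ.≤ t ∸ a
  tail-bound {a} {b} {t} a+b≤t = ℕP.m+n≤o⇒m≤o∸n b (subst (ℕ._≤ t) (ℕP.+-comm a b) a+b≤t)

  ∈-map-∷⁻ : ∀ {m} {h h′ : ℤ} {y : Vec ℤ m} {l} → (h′ ∷ y) ∈ map (h ∷_) l → h′ ≡ h × y ∈ l
  ∈-map-∷⁻ {h = h} p with ∈-map⁻ (h ∷_) p
  ... | y , y∈l , eq with ∷-injective eq
  ... | refl , refl = refl , y∈l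

  +k≢-k : ∀ {k} → 0 ℕ.< k → + k ≢ - + k
  +k≢-k {suc k} _ ()

  sumAll : ∀ {m} → List (Vec ℤ m) → ℤ
  sumAll []      = + 0
  sumAll (y ∷ l) = sumV y + sumAll l

  sumAll-++ : ∀ {m} (l l′ : List (Vec ℤ m)) → sumAll (l ++ l′) ≡ sumAll l + sumAll l′
  sumAll-++ []      l′ = sym (ℤP.+-identityˡ (sumAll l′))
  sumAll-++ (y ∷ l) l′ =
    trans (cong (_+_ (sumV y)) (sumAll-++ l l′)) (sym (ℤP.+-assoc (sumV y) (sumAll l) (sumAll l′)))

  sumAll-map-∷ : ∀ {m} h (l : List (Vec ℤ m)) → sumAll (map (h ∷_) l) ≡ h * + length l + sumAll l
  sumAll-map-∷ h []      = sym (trans (ℤP.+-identityʳ (h * + 0)) (ℤP.*-zeroʳ h))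
  sumAll-map-∷ h (y ∷ l) = begin
    (h + sumV y) + sumAll (map (h ∷_) l)
      ≡⟨ cong (_+_ (h + sumV y)) (sumAll-map-∷ h l) ⟩
    (h + sumV y) + (h * + length l + sumAll l)
      ≡⟨ regroup h (sumV y) (+ length l) (sumAll l) ⟩
    h * (+ 1 + + length l) + (sumV y + sumAll l)
      ≡⟨ cong (λ n → h * n + (sumV y + sumAll l)) (ℤP.pos-+ 1 (length l)) ⟨
    h * + suc (length l) + (sumV y + sumAll l) ∎
    where
    regroup : ∀ h s n r → (h + s) + (h * n + r) ≡ h * (+ 1 + n) + (s + r)
    regroup = solve-∀

  module Shell {m} (F : ℕ → List (Vec ℤ m)) (t : ℕ) where

    block : ℕ → List (Vec ℤ (suc m))
    block j = map (+ (t ∸ j) ∷_) (F j) ++ map (- + (t ∸ j) ∷_) (F j)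

    shell : ℕ → List (Vec ℤ (suc m))
    shell zero    = []
    shell (suc j) = shell j ++ block j

    ∈-block⁻ : ∀ {j h y} → (h ∷ y) ∈ block j → ℤ.∣ h ∣ ≡ t ∸ j × y ∈ F j
    ∈-block⁻ {j} p with ∈-++⁻ (map (+ (t ∸ j) ∷_) (F j)) p
    ... | inj₁ q with ∈-map-∷⁻ q
    ...   | refl , y∈F = refl , y∈F
    ∈-block⁻ {j} p | inj₂ q with ∈-map-∷⁻ q
    ...   | refl , y∈F = ℤP.∣-i∣≡∣i∣ (+ (t ∸ j)) , y∈F

    ∈-shell⁻ : ∀ {n h y} → (h ∷ y) ∈ shell n → ∃[ j ] j ℕ.< n × ℤ.∣ h ∣ ≡ t ∸ j × y ∈ F j
    ∈-shell⁻ {suc n} p with ∈-++⁻ (shell n) p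
    ... | inj₁ q with ∈-shell⁻ q
    ...   | j , j<n , rest = j , ℕP.m<n⇒m<1+n j<n , rest
    ∈-shell⁻ {suc n} p | inj₂ q = n , ℕP.n<1+n n , ∈-block⁻ q

    ∈-shell⁺ : ∀ {n j h y} → j ℕ.< n → h ≡ + (t ∸ j) ⊎ h ≡ - + (t ∸ j) → y ∈ F j → (h ∷ y) ∈ shell n
    ∈-shell⁺ {suc n} {j} j<1+n h≡±k y∈F with j ℕP.≟ n
    ∈-shell⁺ {suc n} {j} _ (inj₁ refl) y∈F | yes refl = ∈-++⁺ʳ (shell j) (∈-++⁺ˡ (∈-map⁺ (+ (t ∸ j) ∷_) y∈F))
    ∈-shell⁺ {suc n} {j} _ (inj₂ refl) y∈F | yes refl = ∈-++⁺ʳ (shell j) (∈-++⁺ʳ _ (∈-map⁺ (- + (t ∸ j) ∷_) y∈F))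
    ... | no j≢n = ∈-++⁺ˡ (∈-shell⁺ (ℕP.≤∧≢⇒< (ℕP.≤-pred j<1+n) j≢n) h≡±k y∈F)

    ∈-shell⁺-byHead : ∀ {a h y} → suc a ℕ.≤ t → h ≡ + suc a ⊎ h ≡ - + suc a → y ∈ F (t ∸ suc a) → (h ∷ y) ∈ shell t
    ∈-shell⁺-byHead {a} {h} 1+a≤t h≡±a =
      ∈-shell⁺ (ℕP.∸-monoʳ-< (ℕ.s≤s z≤n) 1+a≤t) (subst (λ k → h ≡ + k ⊎ h ≡ - + k) (sym t∸[t∸a]≡a) h≡±a)
      where
      t∸[t∸a]≡a : t ∸ (t ∸ suc a) ≡ suc a
      t∸[t∸a]≡a = ℕP.m∸[m∸n]≡n 1+a≤t

    shell-unique : ∀ {n} → n ℕ.≤ t → (∀ j → Unique (F j)) → Unique (shell n)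
    shell-unique {zero}  _     _       = []
    shell-unique {suc n} 1+n≤t F-unique =
      Unique.++⁺ (shell-unique (ℕP.<⇒≤ 1+n≤t) F-unique) block-unique shell⊥block
      where
      0<k : 0 ℕ.< t ∸ n
      0<k = ℕP.m<n⇒0<n∸m 1+n≤t
      block-unique : Unique (block n)
      block-unique = Unique.++⁺ (Unique.map⁺ ∷-injectiveʳ (F-unique n)) (Unique.map⁺ ∷-injectiveʳ (F-unique n)) +⊥-
        where
        +⊥- : ∀ {v} → ¬ (v ∈ map (+ (t ∸ n) ∷_) (F n) × v ∈ map (- + (t ∸ n) ∷_) (F n))
        +⊥- {_ ∷ _} (p , q) with ∈-map-∷⁻ p | ∈-map-∷⁻ q
        ... | refl , _ | h≡-k , _ = +k≢-k 0<k h≡-k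
      shell⊥block : ∀ {v} → ¬ (v ∈ shell n × v ∈ block n)
      shell⊥block {h ∷ _} (p , q) with ∈-shell⁻ p | ∈-block⁻ q
      ... | j , j<n , ∣h∣≡t∸j , _ | ∣h∣≡t∸n , _ =
        ℕP.<-irrefl (ℕP.∸-cancelˡ-≡ (ℕP.<⇒≤ (ℕP.<-trans j<n 1+n≤t)) (ℕP.<⇒≤ 1+n≤t) (trans (sym ∣h∣≡t∸j) ∣h∣≡t∸n))
                    j<n

    length-shell : ∀ {G : ℕ → ℕ} → (∀ j → length (F j) ≡ G j) → ∀ n → length (shell n) ≡ 2 ℕ.* sumBelow G n
    length-shell {G} ∣F∣≡G zero    = refl
    length-shell {G} ∣F∣≡G (suc n) = begin
      length (shell n ++ block n)                     ≡⟨ LP.length-++ (shell n) ⟩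
      length (shell n) ℕ.+ length (block n)           ≡⟨ cong₂ ℕ._+_ (length-shell ∣F∣≡G n) length-block ⟩
      2 ℕ.* sumBelow G n ℕ.+ (G n ℕ.+ G n)            ≡⟨ double (sumBelow G n) (G n) ⟩
      2 ℕ.* (sumBelow G n ℕ.+ G n)                    ∎
      where
      length-map-∷ : ∀ h → length (map (h ∷_) (F n)) ≡ G n
      length-map-∷ h = trans (LP.length-map (h ∷_) (F n)) (∣F∣≡G n)
      length-block : length (block n) ≡ G n ℕ.+ G n
      length-block = trans (LP.length-++ (map (+ (t ∸ n) ∷_) (F n))) (cong₂ ℕ._+_ (length-map-∷ _) (length-map-∷ _))
      double : ∀ s g → 2 ℕ.* s ℕ.+ (g ℕ.+ g) ≡ 2 ℕ.* (s ℕ.+ g)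
      double = ℕ-solve-∀

    sumAll-shell : (∀ j → sumAll (F j) ≡ + 0) → ∀ n → sumAll (shell n) ≡ + 0
    sumAll-shell ΣF≡0 zero    = refl
    sumAll-shell ΣF≡0 (suc n) = begin
      sumAll (shell n ++ block n)
        ≡⟨ sumAll-++ (shell n) (block n) ⟩
      sumAll (shell n) + sumAll (block n)
        ≡⟨ cong₂ _+_ (sumAll-shell ΣF≡0 n) (sumAll-++ (map (k ∷_) (F n)) _) ⟩
      + 0 + (sumAll (map (k ∷_) (F n)) + sumAll (map (- k ∷_) (F n)))
        ≡⟨ cong (_+_ (+ 0)) (cong₂ _+_ (sumAll-map-∷ k (F n)) (sumAll-map-∷ (- k) (F n))) ⟩
      + 0 + ((k * L + sumAll (F n)) + (- k * L + sumAll (F n)))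
        ≡⟨ cong (λ s → + 0 + ((k * L + s) + (- k * L + s))) (ΣF≡0 n) ⟩
      + 0 + ((k * L + + 0) + (- k * L + + 0))
        ≡⟨ cancel k L ⟩
      + 0 ∎
      where
      k = + (t ∸ n)
      L = + length (F n)
      cancel : ∀ k L → + 0 + ((k * L + + 0) + (- k * L + + 0)) ≡ + 0
      cancel = solve-∀

  cross : (m t : ℕ) → List (Vec ℤ m)
  cross zero    t = [] ∷ []
  cross (suc m) t = map (+ 0 ∷_) (cross m t) ++ Shell.shell (cross m) t t

  cross-sound : ∀ m {t} {y : Vec ℤ m} → y ∈ cross m t → ‖ y ‖₁ ℕ.≤ t
  cross-sound zero    {y = []} _ = z≤n
  cross-sound (suc m) {t} {h ∷ y} p with ∈-++⁻ (map (+ 0 ∷_) (cross m t)) p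
  ... | inj₁ q with ∈-map-∷⁻ q
  ...   | refl , y∈cross = cross-sound m y∈cross
  cross-sound (suc m) {t} {h ∷ y} p | inj₂ q with Shell.∈-shell⁻ (cross m) t q
  ... | j , j<t , ∣h∣≡t∸j , y∈cross =
    subst (λ a → a ℕ.+ ‖ y ‖₁ ℕ.≤ t) (sym ∣h∣≡t∸j)
      (ℕP.≤-trans (ℕP.+-monoʳ-≤ (t ∸ j) (cross-sound m y∈cross)) (ℕP.≤-reflexive (ℕP.m∸n+n≡m (ℕP.<⇒≤ j<t))))

  cross-complete : ∀ m {t} (y : Vec ℤ m) → ‖ y ‖₁ ℕ.≤ t → y ∈ cross m t
  cross-complete zero    []             _     = here refl
  cross-complete (suc m) (+ 0 ∷ y)      ‖y‖≤t = ∈-++⁺ˡ (∈-map⁺ (+ 0 ∷_) (cross-complete m y ‖y‖≤t))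
  cross-complete (suc m) (+ suc a ∷ y)  ‖y‖≤t =
    ∈-++⁺ʳ _ (Shell.∈-shell⁺-byHead (cross m) _ (ℕP.m+n≤o⇒m≤o (suc a) ‖y‖≤t) (inj₁ refl)
                                     (cross-complete m y (tail-bound ‖y‖≤t)))
  cross-complete (suc m) (-[1+ a ] ∷ y) ‖y‖≤t =
    ∈-++⁺ʳ _ (Shell.∈-shell⁺-byHead (cross m) _ (ℕP.m+n≤o⇒m≤o (suc a) ‖y‖≤t) (inj₂ refl)
                                     (cross-complete m y (tail-bound ‖y‖≤t)))

  cross-unique : ∀ m t → Unique (cross m t)
  cross-unique zero    t = [] ∷ []
  cross-unique (suc m) t =
    Unique.++⁺ (Unique.map⁺ ∷-injectiveʳ (cross-unique m t)) (Shell.shell-unique (cross m) t ℕP.≤-refl (cross-unique m))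
               axis⊥shell
    where
    axis⊥shell : ∀ {v} → ¬ (v ∈ map (+ 0 ∷_) (cross m t) × v ∈ Shell.shell (cross m) t t)
    axis⊥shell {_ ∷ _} (p , q) with ∈-map-∷⁻ p | Shell.∈-shell⁻ (cross m) t {t} q
    ... | refl , _ | j , j<t , 0≡t∸j , _ = ℕP.<-irrefl 0≡t∸j (ℕP.m<n⇒0<n∸m j<t)

  length-cross : ∀ m t → length (cross m t) ≡ crossCount m t
  length-cross zero    t = refl
  length-cross (suc m) t = begin
    length (map (+ 0 ∷_) (cross m t) ++ Shell.shell (cross m) t t)
      ≡⟨ LP.length-++ (map (+ 0 ∷_) (cross m t)) ⟩
    length (map (+ 0 ∷_) (cross m t)) ℕ.+ length (Shell.shell (cross m) t t)
      ≡⟨ cong₂ ℕ._+_ (trans (LP.length-map (+ 0 ∷_) (cross m t)) (length-cross m t))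
                     (Shell.length-shell (cross m) t (length-cross m) t) ⟩
    crossCount m t ℕ.+ 2 ℕ.* sumBelow (crossCount m) t ∎

  sumAll-cross : ∀ m t → sumAll (cross m t) ≡ + 0
  sumAll-cross zero    t = refl
  sumAll-cross (suc m) t = begin
    sumAll (map (+ 0 ∷_) (cross m t) ++ Shell.shell (cross m) t t)
      ≡⟨ sumAll-++ (map (+ 0 ∷_) (cross m t)) _ ⟩
    sumAll (map (+ 0 ∷_) (cross m t)) + sumAll (Shell.shell (cross m) t t)
      ≡⟨ cong₂ _+_ (sumAll-map-∷ (+ 0) (cross m t)) (Shell.sumAll-shell (cross m) t (sumAll-cross m) t) ⟩
    + 0 * + length (cross m t) + sumAll (cross m t) + + 0
      ≡⟨ cong (λ s → + 0 * + length (cross m t) + s + + 0) (sumAll-cross m t) ⟩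
    + 0 * + length (cross m t) + + 0 + + 0
      ≡⟨ vanish (+ length (cross m t)) ⟩
    + 0 ∎
    where
    vanish : ∀ L → + 0 * L + + 0 + + 0 ≡ + 0
    vanish = solve-∀

  ≤-from-difference : ∀ {i j i′ j′} → j′ - i′ ≡ j - i → i′ ℤ.≤ j′ → i ℤ.≤ j
  ≤-from-difference eq i′≤j′ = ℤP.0≤i-j⇒j≤i (subst (ℤ._≤_ (+ 0)) eq (ℤP.i≤j⇒0≤j-i i′≤j′))

  -‖‖₁≤sumV : ∀ {m} (y : Vec ℤ m) → - + ‖ y ‖₁ ℤ.≤ sumV y
  -‖‖₁≤sumV []       = ℤP.≤-refl
  -‖‖₁≤sumV (y ∷ ys) = subst (ℤ._≤ y + sumV ys) (sym -‖y∷ys‖≡) (ℤP.+-mono-≤ (-∣∣≤ y) (-‖‖₁≤sumV ys))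
    where
    -∣∣≤ : ∀ y → - + ℤ.∣ y ∣ ℤ.≤ y
    -∣∣≤ (+ n)    = ℤP.neg-≤-pos
    -∣∣≤ -[1+ n ] = ℤP.≤-refl
    -‖y∷ys‖≡ : - + ‖ y ∷ ys ‖₁ ≡ - + ℤ.∣ y ∣ + - + ‖ ys ‖₁
    -‖y∷ys‖≡ = trans (cong -_ (ℤP.pos-+ ℤ.∣ y ∣ ‖ ys ‖₁)) (ℤP.neg-distrib-+ (+ ℤ.∣ y ∣) (+ ‖ ys ‖₁))

  -- Meaningful only for ‖y‖₁ ≤ t, where + suc t + sumV y is positive (fibreSize≡).
  fibreSize : ∀ {m} → ℕ → Vec ℤ m → ℕ
  fibreSize t y = ℤ.∣ + suc t + sumV y ∣

  fibrePoint : ∀ {m} → ℕ → Vec ℤ m → ℕ → ℤPoint m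
  fibrePoint t y k = ((+ t - + k) ∷ (+ k - sumV y) ∷ []) , y

  fibreSize≡ : ∀ {m t} (y : Vec ℤ m) → ‖ y ‖₁ ℕ.≤ t → + fibreSize t y ≡ + suc t + sumV y
  fibreSize≡ {t = t} y ‖y‖≤t = ℤP.0≤i⇒+∣i∣≡i (ℤP.≤-trans (ℤ.+≤+ z≤n) 1≤t+1+Σy)
    where
    1≤t+1+Σy : + 1 ℤ.≤ + suc t + sumV y
    1≤t+1+Σy = ≤-from-difference (shift (+ t) (sumV y))
                                 (ℤP.≤-trans (ℤP.neg-mono-≤ (ℤ.+≤+ ‖y‖≤t)) (-‖‖₁≤sumV y))
      where
      shift : ∀ t s → s - - t ≡ (+ 1 + t + s) - + 1
      shift = solve-∀

  fibrePoint-H : ∀ {m t k} (y : Vec ℤ m) → ‖ y ‖₁ ℕ.≤ t → k ℕ.< fibreSize t y → InDilateH t (fibrePoint t y k)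
  fibrePoint-H {t = t} {k} y ‖y‖≤t k<size =
    ℤP.i-j≤i (+ t) (+ k) , x₂≤t , balance (+ t) (+ k) (sumV y) , ‖y‖≤t
    where
    x₂≤t : + k - sumV y ℤ.≤ + t
    x₂≤t = ≤-from-difference (shift (+ t) (+ k) (sumV y))
                             (subst (+ suc k ℤ.≤_) (fibreSize≡ y ‖y‖≤t) (ℤ.+≤+ k<size))
      where
      shift : ∀ t k s → (+ 1 + t + s) - (+ 1 + k) ≡ t - (k - s)
      shift = solve-∀
    balance : ∀ t k s → (t - k) + (k - s) + s ≡ t
    balance = solve-∀

  fibre-algebra : ∀ {T K} x₁ x₂ s → x₁ + x₂ + s ≡ T → K ≡ T - x₁ →
                  (T - x₂ ≡ (+ 1 + T + s) - (+ 1 + K)) × x₁ ≡ T - K × x₂ ≡ K - s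
  fibre-algebra x₁ x₂ s refl refl = gap x₁ x₂ s , back₁ x₁ x₂ s , back₂ x₁ x₂ s
    where
    gap : ∀ x₁ x₂ s → (x₁ + x₂ + s) - x₂ ≡ (+ 1 + (x₁ + x₂ + s) + s) - (+ 1 + ((x₁ + x₂ + s) - x₁))
    gap = solve-∀
    back₁ : ∀ x₁ x₂ s → x₁ ≡ (x₁ + x₂ + s) - ((x₁ + x₂ + s) - x₁)
    back₁ = solve-∀
    back₂ : ∀ x₁ x₂ s → x₂ ≡ ((x₁ + x₂ + s) - x₁) - s
    back₂ = solve-∀

  InDilateH⇒‖‖₁≤ : ∀ {m t} (p : ℤPoint m) → InDilateH t p → ‖ proj₂ p ‖₁ ℕ.≤ t
  InDilateH⇒‖‖₁≤ ((_ ∷ _ ∷ []) , _) (_ , _ , _ , ‖y‖≤t) = ‖y‖≤t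

  H⇒fibrePoint : ∀ {m t} (p : ℤPoint m) → InDilateH t p →
                 ∃[ k ] k ℕ.< fibreSize t (proj₂ p) × p ≡ fibrePoint t (proj₂ p) k
  H⇒fibrePoint {t = t} ((x₁ ∷ x₂ ∷ []) , y) (x₁≤t , x₂≤t , sum≡t , ‖y‖≤t) = k , k<size , point≡
    where
    k = ℤ.∣ + t - x₁ ∣
    algebra = fibre-algebra x₁ x₂ (sumV y) sum≡t (ℤP.0≤i⇒+∣i∣≡i (ℤP.i≤j⇒0≤j-i x₁≤t))
    k<size : k ℕ.< fibreSize t y
    k<size = ℤP.drop‿+≤+
      (subst (ℤ._≤_ (+ suc k)) (sym (fibreSize≡ y ‖y‖≤t)) (≤-from-difference (proj₁ algebra) x₂≤t))
    point≡ : ((x₁ ∷ x₂ ∷ []) , y) ≡ fibrePoint t y k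
    point≡ = cong₂ (λ a b → (a ∷ b ∷ []) , y) (proj₁ (proj₂ algebra)) (proj₂ (proj₂ algebra))

  fibrePoint-injective : ∀ {m t} (y : Vec ℤ m) {k k′} → fibrePoint t y k ≡ fibrePoint t y k′ → k ≡ k′
  fibrePoint-injective {t = t} y {k} {k′} eq = ℤP.+-injective (begin
    + k                ≡⟨ recover (+ t) (+ k) ⟩
    + t - (+ t - + k)  ≡⟨ cong (λ x → + t - x) (∷-injectiveˡ (cong proj₁ eq)) ⟩
    + t - (+ t - + k′) ≡⟨ recover (+ t) (+ k′) ⟨
    + k′               ∎)
    where
    recover : ∀ t k → k ≡ t - (t - k)
    recover = solve-∀

  fibres : ∀ {m} → ℕ → List (Vec ℤ m) → List (ℤPoint m)
  fibres t []      = []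
  fibres t (y ∷ l) = map (fibrePoint t y) (downFrom (fibreSize t y)) ++ fibres t l

  ∈-fibres⁻ : ∀ {m t p} (l : List (Vec ℤ m)) → p ∈ fibres t l →
              ∃[ y ] ∃[ k ] y ∈ l × k ℕ.< fibreSize t y × p ≡ fibrePoint t y k
  ∈-fibres⁻ {t = t} (y ∷ l) p∈ with ∈-++⁻ (map (fibrePoint t y) (downFrom (fibreSize t y))) p∈
  ... | inj₁ q with ∈-map⁻ (fibrePoint t y) q
  ...   | k , k∈ , p≡ = y , k , here refl , ∈-downFrom⁻ k∈ , p≡
  ∈-fibres⁻ (y ∷ l) p∈ | inj₂ q with ∈-fibres⁻ l q
  ... | y′ , k , y′∈l , rest = y′ , k , there y′∈l , rest

  ∈-fibres⁺ : ∀ {m t y k} {l : List (Vec ℤ m)} → y ∈ l → k ℕ.< fibreSize t y → fibrePoint t y k ∈ fibres t l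
  ∈-fibres⁺ {t = t} {l = y ∷ l} (here refl) k<size = ∈-++⁺ˡ (∈-map⁺ (fibrePoint t y) (∈-downFrom⁺ k<size))
  ∈-fibres⁺ {t = t} {l = y ∷ l} (there y∈l) k<size = ∈-++⁺ʳ _ (∈-fibres⁺ y∈l k<size)

  fibres-unique : ∀ {m} t {l : List (Vec ℤ m)} → Unique l → Unique (fibres t l)
  fibres-unique t {[]}    _             = []
  fibres-unique t {y ∷ l} (y∉l ∷ l-unique) =
    Unique.++⁺ (Unique.map⁺ (fibrePoint-injective y) (Unique.downFrom⁺ (fibreSize t y)))
               (fibres-unique t l-unique) disjoint
    where
    disjoint : ∀ {p} → ¬ (p ∈ map (fibrePoint t y) (downFrom (fibreSize t y)) × p ∈ fibres t l)
    disjoint (p∈y , p∈l) with ∈-map⁻ (fibrePoint t y) p∈y | ∈-fibres⁻ l p∈l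
    ... | _ , _ , p≡ | _ , _ , y′∈l , _ , p≡′ = All.lookup y∉l y′∈l (cong proj₂ (trans (sym p≡) p≡′))

  length-fibres : ∀ {m} t (l : List (Vec ℤ m)) → (∀ {y} → y ∈ l → ‖ y ‖₁ ℕ.≤ t) →
                  + length (fibres t l) ≡ + suc t * + length l + sumAll l
  length-fibres t []      _       = sym (trans (ℤP.+-identityʳ (+ suc t * + 0)) (ℤP.*-zeroʳ (+ suc t)))
  length-fibres t (y ∷ l) bounded = begin
    + length (map (fibrePoint t y) (downFrom (fibreSize t y)) ++ fibres t l)
      ≡⟨ cong +_ (LP.length-++ (map (fibrePoint t y) (downFrom (fibreSize t y)))) ⟩
    + (length (map (fibrePoint t y) (downFrom (fibreSize t y))) ℕ.+ length (fibres t l))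
      ≡⟨ ℤP.pos-+ _ (length (fibres t l)) ⟩
    + length (map (fibrePoint t y) (downFrom (fibreSize t y))) + + length (fibres t l)
      ≡⟨ cong₂ _+_ (cong +_ (trans (LP.length-map (fibrePoint t y) (downFrom (fibreSize t y)))
                                   (LP.length-downFrom (fibreSize t y))))
                   (length-fibres t l (bounded ∘ there)) ⟩
    + fibreSize t y + (+ suc t * + length l + sumAll l)
      ≡⟨ cong (_+ (+ suc t * + length l + sumAll l)) (fibreSize≡ y (bounded (here refl))) ⟩
    (+ suc t + sumV y) + (+ suc t * + length l + sumAll l)
      ≡⟨ regroup (+ suc t) (sumV y) (+ length l) (sumAll l) ⟩
    + suc t * (+ 1 + + length l) + (sumV y + sumAll l)
      ≡⟨ cong (λ n → + suc t * n + (sumV y + sumAll l)) (ℤP.pos-+ 1 (length l)) ⟨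
    + suc t * + suc (length l) + (sumV y + sumAll l) ∎
    where
    regroup : ∀ c s n r → (c + s) + (c * n + r) ≡ c * (+ 1 + n) + (s + r)
    regroup = solve-∀

  latticePoints-hasCard : ∀ m t → HasCard (InDilate (suc m) t) (latticeCount (suc m) t)
  latticePoints-hasCard m t =
    fibres t (cross (suc m) t) , fibres-unique t (cross-unique (suc m) t) , ∈⇔ , length≡
    where
    ∈⇔ : ∀ p → (p ∈ fibres t (cross (suc m) t)) ⇔ InDilate (suc m) t p
    ∈⇔ p = mk⇔ sound complete
      where
      sound : p ∈ fibres t (cross (suc m) t) → InDilate (suc m) t p
      sound p∈ with ∈-fibres⁻ (cross (suc m) t) p∈
      ... | y , k , y∈cross , k<size , refl =
        H⇒inDilate t p (fibrePoint-H y (cross-sound (suc m) y∈cross) k<size)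
      complete : InDilate (suc m) t p → p ∈ fibres t (cross (suc m) t)
      complete p∈C with inDilate⇒H t p p∈C
      ... | pH with H⇒fibrePoint p pH
      ... | k , k<size , refl = ∈-fibres⁺ (cross-complete (suc m) (proj₂ p) (InDilateH⇒‖‖₁≤ p pH)) k<size
    length≡ : length (fibres t (cross (suc m) t)) ≡ latticeCount (suc m) t
    length≡ = ℤP.+-injective (begin
      + length (fibres t (cross (suc m) t))
        ≡⟨ length-fibres t (cross (suc m) t) (cross-sound (suc m)) ⟩
      + suc t * + length (cross (suc m) t) + sumAll (cross (suc m) t)
        ≡⟨ cong₂ (λ n s → + suc t * + n + s) (length-cross (suc m) t) (sumAll-cross (suc m) t) ⟩
      + suc t * + crossCount (suc m) t + + 0
        ≡⟨ ℤP.+-identityʳ _ ⟩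
      + suc t * + crossCount (suc m) t
        ≡⟨ ℤP.pos-* (suc t) (crossCount (suc m) t) ⟨
      + latticeCount (suc m) t ∎)

open PowerSeries using (latticeCount; ehrhartS-hstar)
open Enumeration using (latticePoints-hasCard)
open import Data.Nat using (_≤_; _+_)

lemma4p11 : (m : ℕ) → 1 ≤ m →
    Σ (ℕ → ℕ) λ L →
      (∀ t → 1 ≤ t → HasCard (InDilate m t) (L t)) ×
      (∀ n → ((oneMinusZ ^S (m + 2)) *S ehrhartS L) n ≡ hstarClaim m n)
lemma4p11 (suc k) _ = latticeCount (suc k) , (λ t _ → latticePoints-hasCard k t) , ehrhartS-hstar k
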